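{- Let $A\in\mathbb{Z}^{r\times m}$ and $Q\subseteq[m]$ with $r_Q>0$. Then there exists an invertible matrix $P\in\mathbb{Z}^{r\times r}$ such that the submatrix $B = (PA)^Q_{[r_Q]}\in\mathbb{Z}^{r_Q\times|Q|}$ has rank $r_Q$ while $(PA)^{\bar Q}_{[r_Q]}$ has rank $0$. Moreover, for every such $P$: (i) $\mathrm{rk}\big((PA)^{\bar Q}_{[r]\setminus[r_Q]}\big) = \mathrm{rk}(A) - r_Q$; (ii) if $A$ is abundant, then $B$ is abundant; (iii) for every $\mathbf{b}\in\mathbb{Z}^r$ and every $\mathbf{x}\in S(A,\mathbf{b})$ we have $\mathbf{x}^Q\in S(B,\mathbf{c})$, where $\mathbf{c} = (P\mathbf{b})_{[r_Q]}\in\mathbb{Z}^{r_Q}$; in particular, if $A$ is positive then so is $B$; (iv) for every $Q'\subseteq\{1,\dots,|Q|\}$ there exists $Q''\subseteq Q$ with $|Q''| = |Q'|$ and $r_{Q''}(A) = r_{Q'}(B)$.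
   Context: For a matrix $A$ with $m$ columns and $r$ rows: for $Q\subseteq[m]$, $A^Q$ is the matrix keeping only the columns indexed by $Q$ (in their original order, so the columns of $A^Q$ are indexed by $1,\dots,|Q|$), $\bar Q = [m]\setminus Q$; for $R\subseteq[r]$, $A_R$ keeps only the rows indexed by $R$; for a vector $\mathbf{x}$, $\mathbf{x}^Q$ (resp. $\mathbf{x}_R$) keeps only the coordinates indexed by $Q$ (resp. $R$). The empty matrix has rank $0$. $r_Q = r_Q(A) = \mathrm{rk}(A)-\mathrm{rk}(A^{\bar Q})$. $S(A,\mathbf{b}) = \{\mathbf{x}: A\mathbf{x}^T=\mathbf{b}^T\}$ (integer solutions). $A$ is positive if $S(A,\mathbf{0})\cap\mathbb{N}^m\neq\emptyset$; $A$ is abundant if $\mathrm{rk}(A)>0$ and $\mathrm{rk}(A^Q) = \mathrm{rk}(A)$ for all $Q\subseteq[m]$ with $|Q|\geq m-2$. -}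

module Defs where

open import Data.Nat using (ℕ; zero; suc; _∸_; _+_) renaming (_<_ to _<ℕ_)
open import Data.Nat.Properties using (_<?_)
open import Data.Bool using (Bool; true; false)
open import Data.Fin using (Fin; zero; suc; toℕ)
open import Data.Fin.Subset using (Subset; ∣_∣; ∁; _⊆_)
open import Data.Vec using (Vec; []; _∷_; tabulate)
open import Data.Integer using (ℤ; 0ℤ; 1ℤ; _*_; _≤_) renaming (_+_ to _+ℤ_)
open import Data.Product using (Σ; _×_; ∃)
open import Function.Definitions using (Injective)
open import Relation.Binary.PropositionalEquality using (_≡_; _≢_)
open import Relation.Nullary using (¬_; does)

Matrix : ℕ → ℕ → Set
Matrix r m = Fin r → Fin m → ℤ

Vector : ℕ → Set
Vector n = Fin n → ℤ

sumᶠ : {n : ℕ} → (Fin n → ℤ) → ℤ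
sumᶠ {zero}  f = 0ℤ
sumᶠ {suc n} f = f zero +ℤ sumᶠ (λ i → f (suc i))

_⊗_ : {r s m : ℕ} → Matrix r s → Matrix s m → Matrix r m
(P ⊗ A) i j = sumᶠ (λ k → P i k * A k j)

_·_ : {r m : ℕ} → Matrix r m → Vector m → Vector r
(A · x) i = sumᶠ (λ j → A i j * x j)

idMat : (r : ℕ) → Matrix r r
idMat r i j with does (Data.Fin._≟_ i j)
... | true  = 1ℤ
... | false = 0ℤ

Invertible : {r : ℕ} → Matrix r r → Set
Invertible {r} P = Σ (Matrix r r) λ P' →
  (∀ i j → (P ⊗ P') i j ≡ idMat r i j) × (∀ i j → (P' ⊗ P) i j ≡ idMat r i j)

enum : {n : ℕ} (p : Subset n) → Fin ∣ p ∣ → Fin n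
enum (true ∷ p) zero = zero
enum (true ∷ p) (suc i) = suc (enum p i)
enum (false ∷ p) i = suc (enum p i)

cols : {r m : ℕ} (Q : Subset m) → Matrix r m → Matrix r ∣ Q ∣
cols Q A i j = A i (enum Q j)

rows : {r m : ℕ} (R : Subset r) → Matrix r m → Matrix ∣ R ∣ m
rows R A i j = A (enum R i) j

restrict : {m : ℕ} (Q : Subset m) → Vector m → Vector ∣ Q ∣
restrict Q x j = x (enum Q j)

-- [k] = {1,…,k} as a subset of [r]
initSeg : (r k : ℕ) → Subset r
initSeg r k = tabulate (λ (i : Fin r) → does (toℕ i <? k))

-- Linear independence (over ℤ, equivalently over ℚ) of the columns
-- of A selected by f.
IndepCols : {r m k : ℕ} → Matrix r m → (Fin k → Fin m) → Set
IndepCols {r} {m} {k} A f =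
  (c : Vector k) → (∀ i → sumᶠ (λ j → A i (f j) * c j) ≡ 0ℤ) → ∀ j → c j ≡ 0ℤ

Rank : {r m : ℕ} → Matrix r m → ℕ → Set
Rank {r} {m} A k =
  Σ (Fin k → Fin m) (λ f → Injective _≡_ _≡_ f × IndepCols A f)
  × ((g : Fin (suc k) → Fin m) → Injective _≡_ _≡_ g → ¬ IndepCols A g)

RQ : {r m : ℕ} → Matrix r m → Subset m → ℕ → Set
RQ A Q k = Σ ℕ λ a → Σ ℕ λ a' → Rank A a × Rank (cols (∁ Q) A) a' × k ≡ a ∸ a'

Sol : {r m : ℕ} → Matrix r m → Vector r → Vector m → Set
Sol A b x = ∀ i → (A · x) i ≡ b i

Positive : {r m : ℕ} → Matrix r m → Set
Positive {r} {m} A = Σ (Vector m) λ x → Sol A (λ _ → 0ℤ) x × (∀ j → 1ℤ ≤ x j)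

Abundant : {r m : ℕ} → Matrix r m → Set
Abundant {r} {m} A = Σ ℕ λ k → Rank A k × 0 <ℕ k ×
  ((Q : Subset m) → m ∸ 2 Data.Nat.≤ ∣ Q ∣ → Rank (cols Q A) k)

module Submission where

-- P is built by integer row reduction (Euclid's algorithm on pairs of entries):
-- first bring A^{∁Q} to echelon form, move its zero rows to the top, and then reduce the
-- Q-columns of these top rows.  The top r_Q rows of PA then vanish on ∁Q and are independent
-- on Q, which counts the rank: rk A = r_Q + rk A^{∁Q}.
-- For every such P, with N = PA, the key fact is that for T ⊆ Q the columns T ∪ ∁Q of N have
-- rank rk(B^T) + rk(A^{∁Q}): a column of N^T whose B-part is dependent on others differs from
-- that combination by a vector vanishing on the top rows, and such a vector in the column space
-- of N lies in the span of N^{∁Q} by a dimension count.  Since P is invertible, (ii) and (iv)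
-- follow by choosing T = Q minus at most two elements, resp. T = Q minus Q'; (i) and (iii) are
-- read off the block shape of N.

open import Defs
open import Data.Nat as ℕ using (ℕ; zero; suc; s≤s; z≤n; _≤_; _<_; _∸_)
open import Data.Nat.Properties using (_<?_)
import Data.Nat.Properties as ℕP
open import Data.Bool using (true; false; not; T)
open import Data.Bool.Properties using (not-involutive)
open import Data.Unit using (tt)
open import Data.Vec using ([]; _∷_; lookup)
open import Data.Vec.Functional using (insertAt)
open import Data.Vec.Functional.Properties using (insertAt-lookup; insertAt-punchIn)
open import Data.Vec.Properties using ([]=⇒lookup; lookup⇒[]=; lookup∘tabulate; lookup-map)
open import Data.Fin using (Fin; zero; suc; toℕ; opposite; punchIn; punchOut; inject≤; _↑ˡ_; _↑ʳ_)
open import Data.Fin.Properties using (punchInᵢ≢i; punchIn-punchOut; punchOut-injective; punchIn-injective; any?; all?; ¬∀⟶∃¬; inject≤-injective; 0≢1+n; suc-injective; opposite-prop; opposite-involutive; toℕ<n)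
open import Data.Fin.Subset using (Subset; ∣_∣; ∁; _⊆_)
open import Data.Fin.Subset.Properties using (∣∁p∣≡n∸∣p∣)
open import Data.Integer as ℤ using (ℤ; 0ℤ; 1ℤ; _*_; -_; _-_; +_) renaming (_+_ to _+ℤ_)
open import Data.Integer.Properties hiding (_<?_; _≤?_)
open import Data.Integer.DivMod using (_/_; _%_; a≡a%n+[a/n]*n; n%d<d)
open import Data.Integer.Tactic.RingSolver
open import Algebra.Properties.CommutativeSemigroup +-commutativeSemigroup using (x∙yz≈y∙xz; interchange)
open import Relation.Binary.PropositionalEquality
open import Relation.Nullary using (¬_; does; yes; no; Dec; _→-dec_)
open import Relation.Nullary.Decidable using (dec-true)
open import Data.Product using (Σ; _×_; _,_; proj₁; proj₂)
open import Data.Sum using (_⊎_; inj₁; inj₂)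
open import Data.Empty using (⊥-elim)
open import Function using (_∘_)
open import Function.Definitions using (Injective)

-- Sums and matrix products

sumᶠ-cong : ∀ {n} {f g : Fin n → ℤ} → (∀ i → f i ≡ g i) → sumᶠ f ≡ sumᶠ g
sumᶠ-cong {zero} h = refl
sumᶠ-cong {suc n} h = cong₂ _+ℤ_ (h zero) (sumᶠ-cong (λ i → h (suc i)))

sumᶠ-zero : ∀ {n} {f : Fin n → ℤ} → (∀ i → f i ≡ 0ℤ) → sumᶠ f ≡ 0ℤ
sumᶠ-zero {zero} h = refl
sumᶠ-zero {suc n} h = cong₂ _+ℤ_ (h zero) (sumᶠ-zero (λ i → h (suc i)))

sumᶠ-+ : ∀ {n} (f g : Fin n → ℤ) → sumᶠ (λ i → f i +ℤ g i) ≡ sumᶠ f +ℤ sumᶠ g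
sumᶠ-+ {zero} f g = refl
sumᶠ-+ {suc n} f g = trans (cong (f zero +ℤ g zero +ℤ_) (sumᶠ-+ (λ i → f (suc i)) (λ i → g (suc i))))
  (interchange (f zero) (g zero) (sumᶠ (λ i → f (suc i))) (sumᶠ (λ i → g (suc i))))

sumᶠ-*ˡ : ∀ {n} (c : ℤ) (f : Fin n → ℤ) → sumᶠ (λ i → c * f i) ≡ c * sumᶠ f
sumᶠ-*ˡ {zero} c f = sym (*-zeroʳ c)
sumᶠ-*ˡ {suc n} c f = trans (cong (c * f zero +ℤ_) (sumᶠ-*ˡ c (λ i → f (suc i))))
  (sym (*-distribˡ-+ c (f zero) _))

sumᶠ-*ʳ : ∀ {n} (c : ℤ) (f : Fin n → ℤ) → sumᶠ (λ i → f i * c) ≡ sumᶠ f * c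
sumᶠ-*ʳ c f = trans (sumᶠ-cong (λ i → *-comm (f i) c)) (trans (sumᶠ-*ˡ c f) (*-comm c _))

sumᶠ-neg : ∀ {n} (f : Fin n → ℤ) → sumᶠ (λ i → - f i) ≡ - sumᶠ f
sumᶠ-neg {zero} f = refl
sumᶠ-neg {suc n} f = trans (cong (- f zero +ℤ_) (sumᶠ-neg (λ i → f (suc i)))) (sym (neg-distrib-+ (f zero) _))

sumᶠ-swap : ∀ {n m} (f : Fin n → Fin m → ℤ) →
  sumᶠ (λ i → sumᶠ (λ j → f i j)) ≡ sumᶠ (λ j → sumᶠ (λ i → f i j))
sumᶠ-swap {zero} {m} f = sym (sumᶠ-zero {m} (λ j → refl))
sumᶠ-swap {suc n} f = trans (cong (sumᶠ (λ j → f zero j) +ℤ_) (sumᶠ-swap (λ i j → f (suc i) j)))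
  (sym (sumᶠ-+ (λ j → f zero j) (λ j → sumᶠ (λ i → f (suc i) j))))

sumᶠ-*-assoc : ∀ {n m} (p : Fin n → ℤ) (y : Fin n → Fin m → ℤ) (c : Fin m → ℤ) →
  sumᶠ (λ j → sumᶠ (λ k → p k * y k j) * c j) ≡ sumᶠ (λ k → p k * sumᶠ (λ j → y k j * c j))
sumᶠ-*-assoc p y c = begin
  sumᶠ (λ j → sumᶠ (λ k → p k * y k j) * c j)
    ≡⟨ sumᶠ-cong (λ j → sym (sumᶠ-*ʳ (c j) (λ k → p k * y k j))) ⟩
  sumᶠ (λ j → sumᶠ (λ k → p k * y k j * c j))
    ≡⟨ sumᶠ-swap (λ j k → p k * y k j * c j) ⟩
  sumᶠ (λ k → sumᶠ (λ j → p k * y k j * c j))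
    ≡⟨ sumᶠ-cong (λ k → trans (sumᶠ-cong (λ j → *-assoc (p k) (y k j) (c j))) (sumᶠ-*ˡ (p k) (λ j → y k j * c j))) ⟩
  sumᶠ (λ k → p k * sumᶠ (λ j → y k j * c j)) ∎
  where open ≡-Reasoning

⊗-assoc : ∀ {a b c d} (P : Matrix a b) (Q : Matrix b c) (R : Matrix c d) →
  ∀ i j → ((P ⊗ Q) ⊗ R) i j ≡ (P ⊗ (Q ⊗ R)) i j
⊗-assoc P Q R i j = sumᶠ-*-assoc (P i) Q (λ l → R l j)

⊗·-assoc : ∀ {a b c} (P : Matrix a b) (Q : Matrix b c) (x : Vector c) →
  ∀ i → ((P ⊗ Q) · x) i ≡ (P · (Q · x)) i
⊗·-assoc P Q x i = sumᶠ-*-assoc (P i) Q x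

⊗-congʳ : ∀ {a b c} (P : Matrix a b) {Q Q' : Matrix b c} → (∀ i j → Q i j ≡ Q' i j) →
  ∀ i j → (P ⊗ Q) i j ≡ (P ⊗ Q') i j
⊗-congʳ P h i j = sumᶠ-cong (λ k → cong (P i k *_) (h k j))

⊗-congˡ : ∀ {a b c} {P P' : Matrix a b} (Q : Matrix b c) → (∀ i j → P i j ≡ P' i j) →
  ∀ i j → (P ⊗ Q) i j ≡ (P' ⊗ Q) i j
⊗-congˡ Q h i j = sumᶠ-cong (λ k → cong (_* Q k j) (h i k))

·-cong : ∀ {a b} (P : Matrix a b) {x y : Vector b} → (∀ i → x i ≡ y i) → ∀ i → (P · x) i ≡ (P · y) i
·-cong P h i = sumᶠ-cong (λ k → cong (P i k *_) (h k))

sumᶠ-idMatˡ : ∀ {n} (i : Fin n) (f : Fin n → ℤ) → sumᶠ (λ k → idMat n i k * f k) ≡ f i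
sumᶠ-idMatˡ {suc n} zero f = trans (cong (1ℤ * f zero +ℤ_) (sumᶠ-zero {n} (λ k → refl)))
  (trans (+-identityʳ _) (*-identityˡ _))
sumᶠ-idMatˡ {suc n} (suc i) f = trans (cong (0ℤ * f zero +ℤ_)
   (sumᶠ-idMatˡ i (λ k → f (suc k))))
   (+-identityˡ _)

sumᶠ-idMatʳ : ∀ {n} (j : Fin n) (f : Fin n → ℤ) → sumᶠ (λ k → f k * idMat n k j) ≡ f j
sumᶠ-idMatʳ {suc n} zero f = trans (cong (f zero * 1ℤ +ℤ_) (sumᶠ-zero (λ k → *-zeroʳ (f (suc k)))))
  (trans (+-identityʳ _) (*-identityʳ _))
sumᶠ-idMatʳ {suc n} (suc j) f = trans (cong₂ _+ℤ_ (*-zeroʳ (f zero))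
   (sumᶠ-idMatʳ j (λ k → f (suc k))))
   (+-identityˡ _)

idMat-⊗ : ∀ {n m} (A : Matrix n m) → ∀ i j → (idMat n ⊗ A) i j ≡ A i j
idMat-⊗ A i j = sumᶠ-idMatˡ i (λ k → A k j)

idMat-· : ∀ {n} (x : Vector n) → ∀ i → (idMat n · x) i ≡ x i
idMat-· x i = sumᶠ-idMatˡ i x

idMat-invertible : ∀ {n} → Invertible (idMat n)
idMat-invertible {n} = idMat n , (λ i j → idMat-⊗ (idMat n) i j) , (λ i j → idMat-⊗ (idMat n) i j)

⊗-rightInverse : ∀ {n} (P P' Q Q' : Matrix n n) →
  (∀ i j → (P ⊗ P') i j ≡ idMat n i j) → (∀ i j → (Q ⊗ Q') i j ≡ idMat n i j) →
  ∀ i j → ((P ⊗ Q) ⊗ (Q' ⊗ P')) i j ≡ idMat n i j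
⊗-rightInverse {n} P P' Q Q' pp' qq' i j = begin
  ((P ⊗ Q) ⊗ (Q' ⊗ P')) i j ≡⟨ ⊗-assoc P Q (Q' ⊗ P') i j ⟩
  (P ⊗ (Q ⊗ (Q' ⊗ P'))) i j ≡⟨ ⊗-congʳ P (λ a b → sym (⊗-assoc Q Q' P' a b)) i j ⟩
  (P ⊗ ((Q ⊗ Q') ⊗ P')) i j ≡⟨ ⊗-congʳ P (⊗-congˡ P' qq') i j ⟩
  (P ⊗ (idMat n ⊗ P')) i j ≡⟨ ⊗-congʳ P (idMat-⊗ P') i j ⟩
  (P ⊗ P') i j             ≡⟨ pp' i j ⟩
  idMat n i j ∎
  where open ≡-Reasoning

⊗-invertible : ∀ {n} {P Q : Matrix n n} → Invertible P → Invertible Q → Invertible (P ⊗ Q)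
⊗-invertible {P = P} {Q} (P' , pp' , p'p) (Q' , qq' , q'q) =
  Q' ⊗ P' , ⊗-rightInverse P P' Q Q' pp' qq' , ⊗-rightInverse Q' Q P' P q'q p'p

·-zeroʳ : ∀ {n m} (P : Matrix n m) (x : Vector m) → (∀ i → x i ≡ 0ℤ) → ∀ i → (P · x) i ≡ 0ℤ
·-zeroʳ {m = m} P x h i = sumᶠ-zero {m} (λ k → trans (cong (P i k *_) (h k)) (*-zeroʳ (P i k)))

invertible-kernel : ∀ {n} {P : Matrix n n} → Invertible P → (x : Vector n) →
  (∀ i → (P · x) i ≡ 0ℤ) → ∀ i → x i ≡ 0ℤ
invertible-kernel {n} {P} (P' , _ , p'p) x h i = begin
  x i ≡⟨ sym (idMat-· x i) ⟩
  (idMat n · x) i ≡⟨ sym (sumᶠ-cong (λ k → cong (_* x k) (p'p i k))) ⟩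
  ((P' ⊗ P) · x) i ≡⟨ ⊗·-assoc P' P x i ⟩
  (P' · (P · x)) i ≡⟨ ·-zeroʳ P' (P · x) h i ⟩
  0ℤ ∎
  where open ≡-Reasoning

-- Linear dependence over ℤ

Family : ℕ → ℕ → Set
Family k r = Fin k → Vector r

lincomb : ∀ {k r} → Family k r → Vector k → Vector r
lincomb F c i = sumᶠ (λ j → F j i * c j)

lincomb-cong : ∀ {k r} (F : Family k r) {c c' : Vector k} → (∀ j → c j ≡ c' j) → ∀ i → lincomb F c i ≡ lincomb F c' i
lincomb-cong F h i = sumᶠ-cong (λ j → cong (F j i *_) (h j))

lincomb-zeroʳ : ∀ {k r} (F : Family k r) {c : Vector k} → (∀ j → c j ≡ 0ℤ) → ∀ i → lincomb F c i ≡ 0ℤ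
lincomb-zeroʳ {k} F h i = sumᶠ-zero {k} (λ j → trans (cong (F j i *_) (h j)) (*-zeroʳ (F j i)))

lincomb-linear : ∀ {k r} (F : Family k r) (x y : ℤ) (α β : Vector k) →
  ∀ i → lincomb F (λ l → x * α l +ℤ y * β l) i ≡ x * lincomb F α i +ℤ y * lincomb F β i
lincomb-linear F x y α β i = trans (sumᶠ-cong (λ j → distribute (F j i) x y (α j) (β j)))
   (trans (sumᶠ-+ (λ j → x * (F j i * α j)) (λ j → y * (F j i * β j)))
          (cong₂ _+ℤ_ (sumᶠ-*ˡ x (λ j → F j i * α j)) (sumᶠ-*ˡ y (λ j → F j i * β j))))
  where distribute : ∀ f x y a b → f * (x * a +ℤ y * b) ≡ x * (f * a) +ℤ y * (f * b)
        distribute = solve-∀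

lincomb-neg : ∀ {k r} (F : Family k r) (c : Vector k) i → lincomb F (λ j → - c j) i ≡ - lincomb F c i
lincomb-neg F c i = trans (sumᶠ-cong (λ j → sym (neg-distribʳ-* (F j i) (c j)))) (sumᶠ-neg (λ j → F j i * c j))

lincomb-scale : ∀ {k r} (F : Family k r) (x : ℤ) (c : Vector k) i → lincomb F (λ j → x * c j) i ≡ x * lincomb F c i
lincomb-scale F x c i = trans (sumᶠ-cong (λ j → reorder (F j i) x (c j))) (sumᶠ-*ˡ x (λ j → F j i * c j))
  where reorder : ∀ f x c → f * (x * c) ≡ x * (f * c)
        reorder = solve-∀

Independent : ∀ {k r} → Family k r → Set
Independent {k} F = (c : Vector k) → (∀ i → lincomb F c i ≡ 0ℤ) → ∀ j → c j ≡ 0ℤ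

Dependent : ∀ {k r} → Family k r → Set
Dependent {k} F = Σ (Vector k) λ c → (Σ (Fin k) λ j → ¬ c j ≡ 0ℤ) × (∀ i → lincomb F c i ≡ 0ℤ)

dependent⇒¬independent : ∀ {k r} (F : Family k r) → Dependent F → ¬ Independent F
dependent⇒¬independent F (c , (j , nz) , h) ind = nz (ind c h j)

independent-cong : ∀ {k r} {F G : Family k r} → (∀ j i → F j i ≡ G j i) → Independent F → Independent G
independent-cong e ind c h = ind c (λ i → trans (sumᶠ-cong (λ j → cong (_* c j) (e j i))) (h i))

*-nonzero : ∀ a b → ¬ a ≡ 0ℤ → ¬ b ≡ 0ℤ → ¬ a * b ≡ 0ℤ
*-nonzero a b na nb h with i*j≡0⇒i≡0∨j≡0 a h
... | inj₁ a≡0 = na a≡0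
... | inj₂ b≡0 = nb b≡0

*-cancel-nonzero : ∀ a b → ¬ a ≡ 0ℤ → a * b ≡ 0ℤ → b ≡ 0ℤ
*-cancel-nonzero a b na h with i*j≡0⇒i≡0∨j≡0 a h
... | inj₁ a≡0 = ⊥-elim (na a≡0)
... | inj₂ b≡0 = b≡0

+≡0⇒≡- : ∀ x y → x +ℤ y ≡ 0ℤ → x ≡ - y
+≡0⇒≡- x y e = trans (sym (identity x y)) (trans (cong (_+ℤ - y) e) (+-identityˡ (- y)))
  where identity : ∀ x y → x +ℤ y +ℤ - y ≡ x
        identity = solve-∀

sumᶠ-punchIn : ∀ {n} (p : Fin (suc n)) (f : Fin (suc n) → ℤ) →
  sumᶠ f ≡ f p +ℤ sumᶠ (λ j → f (punchIn p j))
sumᶠ-punchIn zero f = refl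
sumᶠ-punchIn {suc n} (suc p) f = trans (cong (f zero +ℤ_) (sumᶠ-punchIn p (λ j → f (suc j))))
  (x∙yz≈y∙xz (f zero) (f (suc p)) _)

punchIn-cases : ∀ {k} (p x : Fin (suc k)) → x ≡ p ⊎ Σ (Fin k) λ j → x ≡ punchIn p j
punchIn-cases p x with x Data.Fin.≟ p
... | yes e = inj₁ e
... | no ne = inj₂ (punchOut (ne ∘ sym) , sym (punchIn-punchOut (ne ∘ sym)))

eliminate-pivot : ∀ {k} (g f : ℤ) (a b d : Vector k) →
  sumᶠ (λ j → (g * a j - b j * f) * d j) ≡ f * (- sumᶠ (λ j → b j * d j)) +ℤ g * sumᶠ (λ j → a j * d j)
eliminate-pivot g f a b d = begin
  sumᶠ (λ j → (g * a j - b j * f) * d j)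
    ≡⟨ sumᶠ-cong (λ j → distribute g f (a j) (b j) (d j)) ⟩
  sumᶠ (λ j → f * (- (b j * d j)) +ℤ g * (a j * d j))
    ≡⟨ sumᶠ-+ (λ j → f * (- (b j * d j))) (λ j → g * (a j * d j)) ⟩
  sumᶠ (λ j → f * (- (b j * d j))) +ℤ sumᶠ (λ j → g * (a j * d j))
    ≡⟨ cong₂ _+ℤ_ (trans (sumᶠ-*ˡ f (λ j → - (b j * d j))) (cong (f *_) (sumᶠ-neg (λ j → b j * d j))))
                  (sumᶠ-*ˡ g (λ j → a j * d j)) ⟩
  f * (- sumᶠ (λ j → b j * d j)) +ℤ g * sumᶠ (λ j → a j * d j) ∎
  where
  open ≡-Reasoning
  distribute : ∀ g f a b d → (g * a - b * f) * d ≡ f * (- (b * d)) +ℤ g * (a * d)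
  distribute = solve-∀

-- Gaussian elimination on the first coordinate, without division: with pivot g = F p 0, every
-- other vector v is replaced by g v − v₀ (F p), whose first coordinate vanishes.  Relations
-- between the reduced vectors and relations of F correspond to each other.
module PivotElimination {k r : ℕ} (F : Family (suc k) (suc r)) (p : Fin (suc k)) (g≢0 : ¬ F p zero ≡ 0ℤ) where
  g : ℤ
  g = F p zero

  reduced : Family k (suc r)
  reduced j i = g * F (punchIn p j) i - F (punchIn p j) zero * F p i

  reducedTail : Family k r
  reducedTail j i = reduced j (suc i)

  reduced-head : ∀ j → reduced j zero ≡ 0ℤ
  reduced-head j = cancel g (F (punchIn p j) zero)
    where cancel : ∀ a b → a * b - b * a ≡ 0ℤ
          cancel = solve-∀

  dependent-lift : Dependent reducedTail → Dependent F
  dependent-lift (d , (j₀ , d≢0) , hd) = c , (punchIn p j₀ , c≢0) , hc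
    where
    cp = - sumᶠ (λ j → F (punchIn p j) zero * d j)
    c = insertAt (λ j → g * d j) p cp
    c≢0 : ¬ c (punchIn p j₀) ≡ 0ℤ
    c≢0 e = *-nonzero g (d j₀) g≢0 d≢0 (trans (sym (insertAt-punchIn _ p cp j₀)) e)
    reduced-relation : ∀ i → lincomb reduced d i ≡ 0ℤ
    reduced-relation zero = sumᶠ-zero (λ j → trans (cong (_* d j) (reduced-head j)) (*-zeroˡ (d j)))
    reduced-relation (suc i) = hd i
    hc : ∀ i → lincomb F c i ≡ 0ℤ
    hc i = begin
      lincomb F c i ≡⟨ sumᶠ-punchIn p (λ j → F j i * c j) ⟩
      F p i * c p +ℤ sumᶠ (λ j → F (punchIn p j) i * c (punchIn p j))
        ≡⟨ cong₂ _+ℤ_ (cong (F p i *_) (insertAt-lookup _ p cp))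
                      (sumᶠ-cong (λ j → cong (F (punchIn p j) i *_) (insertAt-punchIn _ p cp j))) ⟩
      F p i * cp +ℤ sumᶠ (λ j → F (punchIn p j) i * (g * d j))
        ≡⟨ cong (F p i * cp +ℤ_) (trans (sumᶠ-cong (λ j → reorder (F (punchIn p j) i) g (d j)))
                                         (sumᶠ-*ˡ g (λ j → F (punchIn p j) i * d j))) ⟩
      F p i * cp +ℤ g * sumᶠ (λ j → F (punchIn p j) i * d j)
        ≡⟨ sym (eliminate-pivot g (F p i) (λ j → F (punchIn p j) i) (λ j → F (punchIn p j) zero) d) ⟩
      lincomb reduced d i ≡⟨ reduced-relation i ⟩
      0ℤ ∎
      where
      open ≡-Reasoning
      reorder : ∀ a g d → a * (g * d) ≡ g * (a * d)
      reorder = solve-∀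

  independent-lift : Independent reducedTail → Independent F
  independent-lift ind c hc = c≡0
    where
    d : Vector k
    d j = c (punchIn p j)
    row : ∀ i → F p i * c p +ℤ sumᶠ (λ j → F (punchIn p j) i * d j) ≡ 0ℤ
    row i = trans (sym (sumᶠ-punchIn p (λ j → F j i * c j))) (hc i)
    cross : ∀ f g cp SA SB → f * cp +ℤ SA ≡ 0ℤ → g * cp +ℤ SB ≡ 0ℤ → f * (- SB) +ℤ g * SA ≡ 0ℤ
    cross f g cp SA SB h₁ h₂ rewrite +≡0⇒≡- SA (f * cp) (trans (+-comm SA _) h₁)
                                  | +≡0⇒≡- SB (g * cp) (trans (+-comm SB _) h₂) = cancel f g cp
      where cancel : ∀ f g cp → f * (- (- (g * cp))) +ℤ g * (- (f * cp)) ≡ 0ℤ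
            cancel = solve-∀
    d≡0 : ∀ j → d j ≡ 0ℤ
    d≡0 = ind d λ i → trans (eliminate-pivot g (F p (suc i)) (λ j → F (punchIn p j) (suc i)) (λ j → F (punchIn p j) zero) d)
                            (cross (F p (suc i)) g (c p) _ _ (row (suc i)) (row zero))
    cp≡0 : c p ≡ 0ℤ
    cp≡0 = *-cancel-nonzero g (c p) g≢0 (trans (sym (+-identityʳ (g * c p)))
             (trans (cong (g * c p +ℤ_) (sym (sumᶠ-zero {k} (λ j → trans (cong (F (punchIn p j) zero *_) (d≡0 j))
                                                                         (*-zeroʳ (F (punchIn p j) zero))))))
                    (row zero)))
    c≡0 : ∀ x → c x ≡ 0ℤ
    c≡0 x with punchIn-cases p x
    ... | inj₁ refl = cp≡0
    ... | inj₂ (j , refl) = d≡0 j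

zero-row-dependent : ∀ {k r} (F : Family k (suc r)) → (∀ j → F j zero ≡ 0ℤ) → Dependent (λ j i → F j (suc i)) → Dependent F
zero-row-dependent {k} F z (c , nz , h) = c , nz , λ { zero → sumᶠ-zero {k} (λ j → trans (cong (_* c j) (z j)) (*-zeroˡ (c j))) ; (suc i) → h i }

zero-row-independent : ∀ {k r} (F : Family k (suc r)) → Independent (λ j i → F j (suc i)) → Independent F
zero-row-independent F ind c h = ind c (λ i → h (suc i))

dependent⊎independent : ∀ r {k} (F : Family k r) → Dependent F ⊎ Independent F
dependent⊎independent zero {zero} F = inj₂ (λ c h ())
dependent⊎independent zero {suc k} F = inj₁ ((λ _ → 1ℤ) , (zero , λ ()) , λ ())
dependent⊎independent (suc r) {zero} F = inj₂ (λ c h ())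
dependent⊎independent (suc r) {suc k} F with all? (λ j → F j zero ℤ.≟ 0ℤ)
... | yes z = Data.Sum.map (zero-row-dependent F z) (zero-row-independent F) (dependent⊎independent r (λ j i → F j (suc i)))
... | no nz with ¬∀⟶∃¬ (suc k) _ (λ j → F j zero ℤ.≟ 0ℤ) nz
... | (p , g≢0) = Data.Sum.map dependent-lift independent-lift (dependent⊎independent r reducedTail)
  where open PivotElimination F p g≢0

dependent-if-wider : ∀ r {k} (F : Family k r) → r < k → Dependent F
dependent-if-wider zero {suc k} F _ = (λ _ → 1ℤ) , (zero , λ ()) , λ ()
dependent-if-wider (suc r) {suc k} F (s≤s r<k) with all? (λ j → F j zero ℤ.≟ 0ℤ)
... | yes z = zero-row-dependent F z (dependent-if-wider r (λ j i → F j (suc i)) (ℕP.m≤n⇒m≤1+n r<k))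
... | no nz with ¬∀⟶∃¬ (suc k) _ (λ j → F j zero ℤ.≟ 0ℤ) nz
... | (p , g≢0) = dependent-lift (dependent-if-wider r reducedTail r<k)
  where open PivotElimination F p g≢0

dependent-if-supported : ∀ {k r} (F : Family k r) (z : ℕ) (ι : Fin z → Fin r) →
  (∀ x → (∀ l → ¬ ι l ≡ x) → ∀ j → F j x ≡ 0ℤ) → z < k → Dependent F
dependent-if-supported {k} F z ι outside-zero z<k with dependent-if-wider z (λ j l → F j (ι l)) z<k
... | (c , c≢0 , h) = c , c≢0 , relation
  where
  relation : ∀ x → lincomb F c x ≡ 0ℤ
  relation x with any? (λ l → ι l Data.Fin.≟ x)
  ... | yes (l , refl) = h l
  ... | no x∉ = sumᶠ-zero {k} (λ j → trans (cong (_* c j) (outside-zero x (λ l e → x∉ (l , e)) j)) (*-zeroˡ (c j)))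

Inj : ∀ {k n} → (Fin k → Fin n) → Set
Inj f = Injective _≡_ _≡_ f

sumᶠ-reindex : ∀ {k n} (ι : Fin k → Fin n) → Inj ι → (g : Fin n → ℤ) →
  (∀ x → (∀ l → ¬ ι l ≡ x) → g x ≡ 0ℤ) → sumᶠ g ≡ sumᶠ (λ l → g (ι l))
sumᶠ-reindex {zero} {n} ι inj g h = sumᶠ-zero {n} (λ x → h x (λ ()))
sumᶠ-reindex {suc k} {zero} ι inj g h with ι zero
... | ()
sumᶠ-reindex {suc k} {suc n} ι inj g h =
  trans (sumᶠ-punchIn p g) (cong (g p +ℤ_) (trans (sumᶠ-reindex ι' inj' (λ x → g (punchIn p x)) h')
        (sumᶠ-cong (λ l → cong g (punchIn-punchOut (p≢ l))))))
  where
  p = ι zero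
  p≢ : ∀ l → ¬ p ≡ ι (suc l)
  p≢ l e = 0≢1+n (inj e)
  ι' : Fin k → Fin n
  ι' l = punchOut (p≢ l)
  inj' : Inj ι'
  inj' {x} {y} e = suc-injective (inj (punchOut-injective (p≢ x) (p≢ y) e))
  h' : ∀ x → (∀ l → ¬ ι' l ≡ x) → g (punchIn p x) ≡ 0ℤ
  h' x nx = h (punchIn p x) λ { zero e → punchInᵢ≢i p x (sym e)
                              ; (suc l) e → nx l (punchIn-injective p _ _ (trans (punchIn-punchOut (p≢ l)) e)) }

extendByZero : ∀ {k n} (ι : Fin k → Fin n) (c : Vector k) → Vector n
extendByZero ι c x with any? (λ l → ι l Data.Fin.≟ x)
... | yes (l , _) = c l
... | no _ = 0ℤ

extendByZero-image : ∀ {k n} (ι : Fin k → Fin n) → Inj ι → (c : Vector k) → ∀ l → extendByZero ι c (ι l) ≡ c l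
extendByZero-image ι inj c l with any? (λ l' → ι l' Data.Fin.≟ ι l)
... | yes (l' , e) = cong c (inj e)
... | no ne = ⊥-elim (ne (l , refl))

extendByZero-outside : ∀ {k n} (ι : Fin k → Fin n) (c : Vector k) → ∀ x → (∀ l → ¬ ι l ≡ x) → extendByZero ι c x ≡ 0ℤ
extendByZero-outside ι c x nx with any? (λ l' → ι l' Data.Fin.≟ x)
... | yes (l' , e) = ⊥-elim (nx l' e)
... | no ne = refl

lincomb-extendByZero : ∀ {k n r} (F : Family n r) (ι : Fin k → Fin n) → Inj ι → (c : Vector k) →
  ∀ i → lincomb F (extendByZero ι c) i ≡ lincomb (F ∘ ι) c i
lincomb-extendByZero F ι inj c i = trans (sumᶠ-reindex ι inj (λ x → F x i * extendByZero ι c x)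
   (λ x nx → trans (cong (F x i *_) (extendByZero-outside ι c x nx)) (*-zeroʳ (F x i))))
   (sumᶠ-cong (λ l → cong (F (ι l) i *_) (extendByZero-image ι inj c l)))

independent-∘ : ∀ {k n r} (F : Family n r) (ι : Fin k → Fin n) → Inj ι → Independent F → Independent (F ∘ ι)
independent-∘ F ι inj ind c h l = trans (sym (extendByZero-image ι inj c l))
  (ind (extendByZero ι c) (λ i → trans (lincomb-extendByZero F ι inj c i) (h i)) (ι l))

-- Bases and rank

-- v lies in the rational span of W: some nonzero multiple of v is an integer combination of W.
InSpan : ∀ {q r} → Vector r → Family q r → Set
InSpan {q} v W = Σ ℤ λ l → (¬ l ≡ 0ℤ) × Σ (Vector q) λ α → ∀ i → l * v i ≡ lincomb W α i

-- The coefficient vectors of the U j are more than q vectors in ℤ^q; a relation between them,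
-- scaled by the denominators, is a relation between the U j.
steinitz : ∀ {p q r} (U : Family p r) (W : Family q r) → (∀ j → InSpan (U j) W) → q < p → Dependent U
steinitz {p} {q} {r} U W sp q<p with dependent-if-wider q (λ j l → coeff j l) q<p
  where coeff : Fin p → Vector q
        coeff j = proj₁ (proj₂ (proj₂ (sp j)))
... | (c , (j₀ , c≢0) , h) = e , (j₀ , *-nonzero _ _ (proj₁ (proj₂ (sp j₀))) c≢0) , e-relation
  where
  scale : Fin p → ℤ
  scale j = proj₁ (sp j)
  coeff : Fin p → Vector q
  coeff j = proj₁ (proj₂ (proj₂ (sp j)))
  e : Vector p
  e j = scale j * c j
  e-relation : ∀ i → lincomb U e i ≡ 0ℤ
  e-relation i = begin
    sumᶠ (λ j → U j i * (scale j * c j))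
      ≡⟨ sumᶠ-cong (λ j → trans (reorder (U j i) (scale j) (c j)) (cong (_* c j) (proj₂ (proj₂ (proj₂ (sp j))) i))) ⟩
    sumᶠ (λ j → sumᶠ (λ l → W l i * coeff j l) * c j)
      ≡⟨ sumᶠ-*-assoc (λ l → W l i) (λ l j → coeff j l) c ⟩
    sumᶠ (λ l → W l i * sumᶠ (λ j → coeff j l * c j))
      ≡⟨ sumᶠ-zero {q} (λ l → trans (cong (W l i *_) (h l)) (*-zeroʳ (W l i))) ⟩
    0ℤ ∎
    where
    open ≡-Reasoning
    reorder : ∀ u l c → u * (l * c) ≡ (l * u) * c
    reorder = solve-∀

member-inSpan : ∀ {q r} (W : Family q r) l → InSpan (W l) W
member-inSpan {q} W l = 1ℤ , (λ ()) , (λ k → idMat q k l) , λ i → trans (*-identityˡ (W l i)) (sym (sumᶠ-idMatʳ l (λ k → W k i)))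

Basis : ∀ {n r} → Family n r → ℕ → Set
Basis {n} F k = Σ (Fin k → Fin n) λ f → Inj f × Independent (F ∘ f) × (∀ j → InSpan (F j) (F ∘ f))

zero-cons : ∀ {k} → Vector k → Vector (suc k)
zero-cons α zero = 0ℤ
zero-cons α (suc l) = α l

-- Scan the family from the back, keeping F 0 exactly when it is independent of the members kept so far.
greedy-basis : ∀ {n r} (F : Family n r) → Σ ℕ (Basis F)
greedy-basis {zero} F = 0 , (λ ()) , (λ {x} → λ { }) , (λ c h ()) , (λ ())
greedy-basis {suc n} {r} F with greedy-basis (F ∘ suc)
... | (k , f , inj , ind , sp) with dependent⊎independent r (F ∘ zero-or-suc)
  where zero-or-suc : Fin (suc k) → Fin (suc n)
        zero-or-suc zero = zero
        zero-or-suc (suc l) = suc (f l)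
... | inj₂ ind₀ = suc k , zero-or-suc , inj₀ , ind₀ , sp₀
  where
  zero-or-suc : Fin (suc k) → Fin (suc n)
  zero-or-suc zero = zero
  zero-or-suc (suc l) = suc (f l)
  inj₀ : Inj zero-or-suc
  inj₀ {zero} {zero} e = refl
  inj₀ {suc x} {suc y} e = cong suc (inj (suc-injective e))
  sp₀ : ∀ j → InSpan (F j) (F ∘ zero-or-suc)
  sp₀ zero = member-inSpan (F ∘ zero-or-suc) zero
  sp₀ (suc j) with sp j
  ... | (l , l≢0 , α , h) = l , l≢0 , zero-cons α ,
        λ i → trans (h i) (sym (trans (cong (_+ℤ lincomb (F ∘ suc ∘ f) α i) (*-zeroʳ (F zero i))) (+-identityˡ _)))
... | inj₁ (c , (j₀ , c≢0) , h) = k , suc ∘ f , (λ e → inj (suc-injective e)) , ind , sp₀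
  where
  rest = lincomb (F ∘ suc ∘ f) (c ∘ suc)
  h' : ∀ i → F zero i * c zero +ℤ rest i ≡ 0ℤ
  h' = h
  sp₀ : ∀ j → InSpan (F j) (F ∘ suc ∘ f)
  sp₀ (suc j) = sp j
  sp₀ zero with c zero ℤ.≟ 0ℤ
  ... | yes c0≡0 = ⊥-elim (c≢0 (c≡0 j₀))
    where
    rest≡0 : ∀ i → rest i ≡ 0ℤ
    rest≡0 i = trans (sym (trans (cong (_+ℤ rest i) (trans (cong (F zero i *_) c0≡0) (*-zeroʳ (F zero i))))
                                 (+-identityˡ _)))
                     (h' i)
    c≡0 : ∀ j → c j ≡ 0ℤ
    c≡0 zero = c0≡0
    c≡0 (suc j) = ind (c ∘ suc) rest≡0 j
  ... | no c0≢0 = c zero , c0≢0 , (λ l → - c (suc l)) , λ i → begin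
    c zero * F zero i ≡⟨ +≡0⇒≡- _ (rest i) (trans (cong (_+ℤ rest i) (*-comm (c zero) (F zero i))) (h' i)) ⟩
    - rest i ≡⟨ sym (lincomb-neg (F ∘ suc ∘ f) (c ∘ suc) i) ⟩
    lincomb (F ∘ suc ∘ f) (λ l → - c (suc l)) i ∎
    where open ≡-Reasoning

col : ∀ {r m} → Matrix r m → Family m r
col X j i = X i j

basis⇒rank : ∀ {r m} (X : Matrix r m) {k} → Basis (col X) k → Rank X k
basis⇒rank X {k} (f , inj , ind , sp) = (f , inj , ind) ,
  λ g _ gind → dependent⇒¬independent (col X ∘ g) (steinitz (col X ∘ g) (col X ∘ f) (λ j → sp (g j)) (ℕP.n<1+n k)) gind

rank-exists : ∀ {r m} (X : Matrix r m) → Σ ℕ (Rank X)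
rank-exists X with greedy-basis (col X)
... | (k , b) = k , basis⇒rank X b

independent⇒≤rank : ∀ {r m} (X : Matrix r m) {e k} → Rank X e → (h : Fin k → Fin m) → Inj h → Independent (col X ∘ h) → k ≤ e
independent⇒≤rank X {e} {k} (_ , maximal) h h-inj ind with k ℕP.≤? e
... | yes k≤e = k≤e
... | no k≰e = ⊥-elim (maximal (h ∘ ι) (λ x → inject≤-injective lt lt _ _ (h-inj x))
                                 (independent-∘ (col X ∘ h) ι (λ x → inject≤-injective lt lt _ _ x) ind))
  where
  lt : suc e ≤ k
  lt = ℕP.≰⇒> k≰e
  ι : Fin (suc e) → Fin k
  ι x = inject≤ x lt

rank-unique : ∀ {r m} (X : Matrix r m) {k k'} → Rank X k → Rank X k' → k ≡ k'
rank-unique X rk@((f , f-inj , f-ind) , _) rk'@((f' , f'-inj , f'-ind) , _) =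
  ℕP.≤-antisym (independent⇒≤rank X rk' f f-inj f-ind) (independent⇒≤rank X rk f' f'-inj f'-ind)

rank-basis : ∀ {r m} (X : Matrix r m) {k} → Rank X k → Basis (col X) k
rank-basis X rk with greedy-basis (col X)
... | (k₀ , b) = subst (Basis (col X)) (rank-unique X (basis⇒rank X b) rk) b

Relations⊆ : ∀ {r r' m} → Matrix r m → Matrix r' m → Set
Relations⊆ {r} {r'} {m} X Y = ∀ {k} (f : Fin k → Fin m) (c : Vector k) →
  (∀ i → lincomb (col X ∘ f) c i ≡ 0ℤ) → ∀ i → lincomb (col Y ∘ f) c i ≡ 0ℤ

rank-relations : ∀ {r r' m} (X : Matrix r m) (Y : Matrix r' m) → Relations⊆ X Y → Relations⊆ Y X →
  ∀ {k} → Rank X k → Rank Y k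
rank-relations X Y xy yx ((f , inj , ind) , maximal) =
  (f , inj , λ c h → ind c (yx f c h)) , λ g g-inj gind → maximal g g-inj (λ c h → gind c (xy g c h))

lincomb-⊗ : ∀ {r s m k} (P : Matrix r s) (X : Matrix s m) (f : Fin k → Fin m) (c : Vector k) →
  ∀ i → lincomb (col (P ⊗ X) ∘ f) c i ≡ (P · lincomb (col X ∘ f) c) i
lincomb-⊗ P X f c i = sumᶠ-*-assoc (P i) (λ l j → X l (f j)) c

rank-invertible-⊗ : ∀ {r m} {P : Matrix r r} → Invertible P → (X : Matrix r m) → ∀ {k} → Rank X k → Rank (P ⊗ X) k
rank-invertible-⊗ {P = P} inv X = rank-relations X (P ⊗ X)
  (λ f c h i → trans (lincomb-⊗ P X f c i) (·-zeroʳ P _ h i))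
  (λ f c h → invertible-kernel inv _ (λ i → trans (sym (lincomb-⊗ P X f c i)) (h i)))

-- Subsets and their enumerations

enum-lookup : ∀ {n} (p : Subset n) k → lookup p (enum p k) ≡ true
enum-lookup (true ∷ p) zero = refl
enum-lookup (true ∷ p) (suc k) = enum-lookup p k
enum-lookup (false ∷ p) k = enum-lookup p k

lookup-enum : ∀ {n} (p : Subset n) x → lookup p x ≡ true → Σ (Fin ∣ p ∣) λ k → enum p k ≡ x
lookup-enum (true ∷ p) zero h = zero , refl
lookup-enum (true ∷ p) (suc x) h with lookup-enum p x h
... | (k , e) = suc k , cong suc e
lookup-enum (false ∷ p) zero ()
lookup-enum (false ∷ p) (suc x) h with lookup-enum p x h
... | (k , e) = k , cong suc e

enum-injective : ∀ {n} (p : Subset n) → Inj (enum p)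
enum-injective (true ∷ p) {zero} {zero} e = refl
enum-injective (true ∷ p) {zero} {suc y} ()
enum-injective (true ∷ p) {suc x} {zero} ()
enum-injective (true ∷ p) {suc x} {suc y} e = cong suc (enum-injective p (suc-injective e))
enum-injective (false ∷ p) e = enum-injective p (suc-injective e)

lookup-∁ : ∀ {n} (p : Subset n) x → lookup (∁ p) x ≡ not (lookup p x)
lookup-∁ p x = lookup-map x not p

not-true : ∀ {b} → not b ≡ true → b ≡ false
not-true {false} e = refl
enum-cover : ∀ {n} (p : Subset n) x → (Σ (Fin ∣ p ∣) λ k → enum p k ≡ x) ⊎ (Σ (Fin ∣ ∁ p ∣) λ k → enum (∁ p) k ≡ x)
enum-cover p x with lookup p x in eq
... | true = inj₁ (lookup-enum p x eq)
... | false = inj₂ (lookup-enum (∁ p) x (trans (lookup-∁ p x) (cong not eq)))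

enum-∁-out : ∀ {n} (p : Subset n) k → lookup p (enum (∁ p) k) ≡ false
enum-∁-out p k = not-true (trans (sym (lookup-∁ p (enum (∁ p) k))) (enum-lookup (∁ p) k))

true≢false : ¬ true ≡ false
true≢false ()

enum≢enum∁ : ∀ {m} (Q : Subset m) t k → ¬ enum Q t ≡ enum (∁ Q) k
enum≢enum∁ Q t k e = true≢false (trans (sym (enum-lookup Q t)) (trans (cong (lookup Q) e) (enum-∁-out Q k)))

sumᶠ-split : ∀ {n} (p : Subset n) (f : Fin n → ℤ) →
  sumᶠ f ≡ sumᶠ (λ k → f (enum p k)) +ℤ sumᶠ (λ k → f (enum (∁ p) k))
sumᶠ-split [] f = refl
sumᶠ-split (true ∷ p) f = trans (cong (f zero +ℤ_) (sumᶠ-split p (f ∘ suc))) (sym (+-assoc (f zero) _ _))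
sumᶠ-split (false ∷ p) f = trans (cong (f zero +ℤ_) (sumᶠ-split p (f ∘ suc))) (x∙yz≈y∙xz (f zero) (sumᶠ (λ k → f (suc (enum p k)))) _)

lookup-initSeg : ∀ r k (x : Fin r) → lookup (initSeg r k) x ≡ does (toℕ x <? k)
lookup-initSeg r k x = lookup∘tabulate (λ (i : Fin r) → does (toℕ i <? k)) x

enum-initSeg-onto : ∀ r s (x : Fin r) → toℕ x < s → Σ (Fin ∣ initSeg r s ∣) λ k → enum (initSeg r s) k ≡ x
enum-initSeg-onto r s x lt = lookup-enum (initSeg r s) x (trans (lookup-initSeg r s x) (dec-true (toℕ x <? s) lt))

∣initSeg∣≤ : ∀ r k → ∣ initSeg r k ∣ ≤ k
∣initSeg∣≤ zero k = z≤n
∣initSeg∣≤ (suc r) zero = ∣initSeg∣≤ r zero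
∣initSeg∣≤ (suc r) (suc k) = s≤s (∣initSeg∣≤ r k)

enum-initSeg< : ∀ n s (i : Fin ∣ initSeg n s ∣) → toℕ (enum (initSeg n s) i) < s
enum-initSeg< n s i = ℕP.≤ᵇ⇒≤ (suc (toℕ (enum (initSeg n s) i))) s
  (subst T (sym (trans (sym (lookup-initSeg n s (enum (initSeg n s) i))) (enum-lookup (initSeg n s) i))) tt)

liftSubset : ∀ {m} (Q : Subset m) → Subset ∣ Q ∣ → Subset m
liftSubset [] T = []
liftSubset (true ∷ Q) (b ∷ T) = b ∷ liftSubset Q T
liftSubset (false ∷ Q) T = false ∷ liftSubset Q T

liftSubset-enum : ∀ {m} (Q : Subset m) T t → lookup (liftSubset Q T) (enum Q t) ≡ lookup T t
liftSubset-enum (true ∷ Q) (b ∷ T) zero = refl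
liftSubset-enum (true ∷ Q) (b ∷ T) (suc t) = liftSubset-enum Q T t
liftSubset-enum (false ∷ Q) T t = liftSubset-enum Q T t

liftSubset-outside : ∀ {m} (Q : Subset m) T j → lookup Q j ≡ false → lookup (liftSubset Q T) j ≡ false
liftSubset-outside (true ∷ Q) (b ∷ T) zero ()
liftSubset-outside (true ∷ Q) (b ∷ T) (suc j) h = liftSubset-outside Q T j h
liftSubset-outside (false ∷ Q) T zero h = refl
liftSubset-outside (false ∷ Q) T (suc j) h = liftSubset-outside Q T j h

∁liftSubset-enum : ∀ {m} (Q : Subset m) T t → lookup (∁ (liftSubset Q T)) (enum Q t) ≡ not (lookup T t)
∁liftSubset-enum Q T t = trans (lookup-∁ (liftSubset Q T) (enum Q t)) (cong not (liftSubset-enum Q T t))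

∁liftSubset-enum∁ : ∀ {m} (Q : Subset m) T k → lookup (∁ (liftSubset Q T)) (enum (∁ Q) k) ≡ true
∁liftSubset-enum∁ Q T k = trans (lookup-∁ (liftSubset Q T) (enum (∁ Q) k))
                                (cong not (liftSubset-outside Q T (enum (∁ Q) k) (enum-∁-out Q k)))

liftSubset-card : ∀ {m} (Q : Subset m) T → ∣ liftSubset Q T ∣ ≡ ∣ T ∣
liftSubset-card [] [] = refl
liftSubset-card (true ∷ Q) (true ∷ T) = cong suc (liftSubset-card Q T)
liftSubset-card (true ∷ Q) (false ∷ T) = liftSubset-card Q T
liftSubset-card (false ∷ Q) T = liftSubset-card Q T

liftSubset-⊆ : ∀ {m} (Q : Subset m) T → liftSubset Q T ⊆ Q
liftSubset-⊆ Q T {x} h with lookup Q x in eq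
... | true = lookup⇒[]= x Q eq
... | false = ⊥-elim (true≢false (trans (sym ([]=⇒lookup h)) (liftSubset-outside Q T x eq)))

zero⇒rank0 : ∀ {r m} (X : Matrix r m) → (∀ i j → X i j ≡ 0ℤ) → Rank X 0
zero⇒rank0 {r} X z = ((λ ()) , (λ { {()} }) , (λ c h ())) ,
  λ g gi ind → one≢0 (ind (λ _ → 1ℤ) (λ i → trans (cong (_+ℤ 0ℤ) (trans (cong (_* 1ℤ) (z i (g zero))) (*-zeroˡ 1ℤ))) refl) zero)
  where one≢0 : ¬ 1ℤ ≡ 0ℤ
        one≢0 ()

rank0⇒zero : ∀ {r m} (X : Matrix r m) → Rank X 0 → ∀ i j → X i j ≡ 0ℤ
rank0⇒zero X (_ , maximal) i j with X i j ℤ.≟ 0ℤ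
... | yes e = e
... | no ne = ⊥-elim (maximal (λ _ → j) (λ {x} {y} _ → one x y) ind)
  where
  one : ∀ (x y : Fin 1) → x ≡ y
  one zero zero = refl
  ind : IndepCols X (λ _ → j)
  ind c h zero = *-cancel-nonzero (X i j) (c zero) ne (trans (sym (+-identityʳ _)) (h i))

-- Concatenated families and spans

append : ∀ {k1 k2} {A : Set} → (Fin k1 → A) → (Fin k2 → A) → Fin (k1 ℕ.+ k2) → A
append {zero} f g x = g x
append {suc k1} f g zero = f zero
append {suc k1} f g (suc x) = append (f ∘ suc) g x

append-↑ˡ : ∀ {k1 k2} {A : Set} (f : Fin k1 → A) (g : Fin k2 → A) l → append f g (l ↑ˡ k2) ≡ f l
append-↑ˡ {suc k1} f g zero = refl
append-↑ˡ {suc k1} f g (suc l) = append-↑ˡ (f ∘ suc) g l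

append-↑ʳ : ∀ {k1 k2} {A : Set} (f : Fin k1 → A) (g : Fin k2 → A) y → append f g (k1 ↑ʳ y) ≡ g y
append-↑ʳ {zero} f g y = refl
append-↑ʳ {suc k1} f g y = append-↑ʳ (f ∘ suc) g y

↑-cases : ∀ {k1 k2} (x : Fin (k1 ℕ.+ k2)) → (Σ (Fin k1) λ l → x ≡ l ↑ˡ k2) ⊎ (Σ (Fin k2) λ y → x ≡ k1 ↑ʳ y)
↑-cases {zero} x = inj₂ (x , refl)
↑-cases {suc k1} zero = inj₁ (zero , refl)
↑-cases {suc k1} (suc x) with ↑-cases {k1} x
... | inj₁ (l , e) = inj₁ (suc l , cong suc e)
... | inj₂ (y , e) = inj₂ (y , cong suc e)

append-all : ∀ {k1 k2} {A : Set} (P : A → Set) (f : Fin k1 → A) (g : Fin k2 → A) →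
  (∀ l → P (f l)) → (∀ y → P (g y)) → ∀ x → P (append f g x)
append-all {zero} P f g hf hg x = hg x
append-all {suc k1} P f g hf hg zero = hf zero
append-all {suc k1} P f g hf hg (suc x) = append-all P (f ∘ suc) g (hf ∘ suc) hg x

all-↑-zero : ∀ {k1 k2} (c : Vector (k1 ℕ.+ k2)) → (∀ l → c (l ↑ˡ k2) ≡ 0ℤ) → (∀ y → c (k1 ↑ʳ y) ≡ 0ℤ) → ∀ x → c x ≡ 0ℤ
all-↑-zero {k1} {k2} c h1 h2 x with ↑-cases {k1} {k2} x
... | inj₁ (l , refl) = h1 l
... | inj₂ (y , refl) = h2 y

append-injective : ∀ {k1 k2 n} (f : Fin k1 → Fin n) (g : Fin k2 → Fin n) → Inj f → Inj g →
  (∀ l y → ¬ f l ≡ g y) → Inj (append f g)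
append-injective {zero} f g fi gi d e = gi e
append-injective {suc k1} f g fi gi d {zero} {zero} e = refl
append-injective {suc k1} f g fi gi d {zero} {suc y} e = ⊥-elim (append-all (λ v → ¬ f zero ≡ v) (f ∘ suc) g (λ l e' → 0≢1+n (fi e')) (d zero) y e)
append-injective {suc k1} f g fi gi d {suc x} {zero} e = ⊥-elim (append-all (λ v → ¬ f zero ≡ v) (f ∘ suc) g (λ l e' → 0≢1+n (fi e')) (d zero) x (sym e))
append-injective {suc k1} f g fi gi d {suc x} {suc y} e = cong suc (append-injective (f ∘ suc) g (λ e' → suc-injective (fi e')) gi (λ l → d (suc l)) e)

append-map : ∀ {k1 k2} {A B : Set} (h : A → B) (f : Fin k1 → A) (g : Fin k2 → A) x → h (append f g x) ≡ append (h ∘ f) (h ∘ g) x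
append-map {zero} h f g x = refl
append-map {suc k1} h f g zero = refl
append-map {suc k1} h f g (suc x) = append-map h (f ∘ suc) g x

lincomb-append : ∀ {k1 k2 r} (F : Family k1 r) (G : Family k2 r) (c : Vector (k1 ℕ.+ k2)) →
  ∀ i → lincomb (append F G) c i ≡ lincomb F (λ l → c (l ↑ˡ k2)) i +ℤ lincomb G (λ y → c (k1 ↑ʳ y)) i
lincomb-append {zero} F G c i = sym (+-identityˡ _)
lincomb-append {suc k1} F G c i = trans (cong (F zero i * c zero +ℤ_) (lincomb-append (F ∘ suc) G (c ∘ suc) i))
  (sym (+-assoc (F zero i * c zero) _ _))

inSpan-cong : ∀ {q r} {u v : Vector r} {W : Family q r} → (∀ i → u i ≡ v i) → InSpan u W → InSpan v W
inSpan-cong e (l , nz , α , h) = l , nz , α , λ i → trans (cong (l *_) (sym (e i))) (h i)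

inSpan-* : ∀ {q r} {v : Vector r} {W : Family q r} (c : ℤ) → InSpan v W → InSpan (λ i → v i * c) W
inSpan-* {v = v} {W} c (l , nz , α , h) = l , nz , (λ k → α k * c) , λ i →
  trans (sym (*-assoc l (v i) c)) (trans (cong (_* c) (h i)) (trans (sym (sumᶠ-*ʳ c (λ j → W j i * α j)))
    (sumᶠ-cong (λ j → *-assoc (W j i) (α j) c))))

inSpan-+ : ∀ {q r} {u v : Vector r} {W : Family q r} → InSpan u W → InSpan v W → InSpan (λ i → u i +ℤ v i) W
inSpan-+ {u = u} {v} {W} (l1 , nz1 , α , h1) (l2 , nz2 , β , h2) =
  l1 * l2 , *-nonzero l1 l2 nz1 nz2 , (λ k → l2 * α k +ℤ l1 * β k) , λ i →
  trans (distribute l1 l2 (u i) (v i)) (trans (cong₂ _+ℤ_ (cong (l2 *_) (h1 i)) (cong (l1 *_) (h2 i)))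
    (sym (lincomb-linear W l2 l1 α β i)))
  where distribute : ∀ a b x y → a * b * (x +ℤ y) ≡ b * (a * x) +ℤ a * (b * y)
        distribute = solve-∀

zero-inSpan : ∀ {q r} (W : Family q r) → InSpan (λ _ → 0ℤ) W
zero-inSpan {q} W = 1ℤ , (λ ()) , (λ _ → 0ℤ) , λ i → sym (lincomb-zeroʳ W (λ _ → refl) i)

lincomb-inSpan : ∀ {s q r} (K : Family s r) (W : Family q r) → (∀ x → InSpan (K x) W) → (γ : Vector s) → InSpan (lincomb K γ) W
lincomb-inSpan {zero} K W h γ = zero-inSpan W
lincomb-inSpan {suc s} K W h γ = inSpan-+ {u = λ i → K zero i * γ zero} {v = lincomb (K ∘ suc) (γ ∘ suc)} {W = W} (inSpan-* {W = W} (γ zero) (h zero)) (lincomb-inSpan (K ∘ suc) W (h ∘ suc) (γ ∘ suc))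

inSpan-appendʳ : ∀ {k1 k2 r} {v : Vector r} (F : Family k1 r) (G : Family k2 r) → InSpan v G → InSpan v (append F G)
inSpan-appendʳ {k1} {k2} {v = v} F G (l , nz , α , h) = l , nz , append (λ _ → 0ℤ) α , λ i →
  trans (h i) (sym (trans (lincomb-append F G (append (λ _ → 0ℤ) α) i)
    (trans (cong₂ _+ℤ_ (lincomb-zeroʳ F (λ j → append-↑ˡ {k1} {k2} (λ _ → 0ℤ) α j) i) (lincomb-cong G (λ y → append-↑ʳ {k1} {k2} (λ _ → 0ℤ) α y) i))
      (+-identityˡ _))))

independentIn⇒≤rank : ∀ {r m} (X : Matrix r m) (S : Subset m) {e k} → Rank (cols S X) e → (h : Fin k → Fin m) → Inj h →
  (∀ x → lookup S (h x) ≡ true) → Independent (col X ∘ h) → k ≤ e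
independentIn⇒≤rank X S rk h hi hS ind = independent⇒≤rank (cols S X) rk h' hi'
   (independent-cong (λ j i → cong (X i) (sym (proj₂ (lookup-enum S (h j) (hS j))))) ind)
  where
  h' = λ x → proj₁ (lookup-enum S (h x) (hS x))
  hi' : Inj h'
  hi' {x} {y} e = hi (trans (sym (proj₂ (lookup-enum S (h x) (hS x)))) (trans (cong (enum S) e) (proj₂ (lookup-enum S (h y) (hS y)))))

spannedBy⇒rank≤ : ∀ {r m} (X : Matrix r m) (S : Subset m) {e q} → Rank (cols S X) e → (W : Family q r) →
  (∀ j → lookup S j ≡ true → InSpan (col X j) W) → e ≤ q
spannedBy⇒rank≤ {r} X S {e} {q} ((φ , φi , φind) , _) W sp with e ℕP.≤? q
... | yes le = le
... | no nle = ⊥-elim (dependent⇒¬independent (col X ∘ enum S ∘ φ) (steinitz (col X ∘ enum S ∘ φ) W (λ x → sp _ (enum-lookup S (φ x))) (ℕP.≰⇒> nle)) φind)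

-- The block structure of P A

module BlockRank {r m : ℕ} (N : Matrix r m) (Q : Subset m) (R : Subset r) (rQ a a' : ℕ)
  (top-zero : ∀ i j → N (enum R i) (enum (∁ Q) j) ≡ 0ℤ)
  (basisB : Basis (col (rows R (cols Q N))) rQ) (basisN : Basis (col N) a)
  (basis∁Q : Basis (col (cols (∁ Q) N)) a')
  (a≡rQ+a' : a ≡ rQ ℕ.+ a') where

  B : Matrix ∣ R ∣ ∣ Q ∣
  B = rows R (cols Q N)

  colN : Family m r
  colN = col N

  β : Fin rQ → Fin ∣ Q ∣
  β = proj₁ basisB
  β-independent : Independent (col B ∘ β)
  β-independent = proj₁ (proj₂ (proj₂ basisB))

  ψ : Fin a → Fin m
  ψ = proj₁ basisN
  ψ-spans : ∀ j → InSpan (colN j) (colN ∘ ψ)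
  ψ-spans = proj₂ (proj₂ (proj₂ basisN))

  δ : Fin a' → Fin ∣ ∁ Q ∣
  δ = proj₁ basis∁Q
  δ-injective : Inj δ
  δ-injective = proj₁ (proj₂ basis∁Q)
  δ-independent : Independent (col (cols (∁ Q) N) ∘ δ)
  δ-independent = proj₁ (proj₂ (proj₂ basis∁Q))
  δ-spans : ∀ j → InSpan (col (cols (∁ Q) N) j) (col (cols (∁ Q) N) ∘ δ)
  δ-spans = proj₂ (proj₂ (proj₂ basis∁Q))

  Zδ : Fin a' → Fin m
  Zδ y = enum (∁ Q) (δ y)

  -- On the rows R the δ columns and v vanish, leaving B^K c₁ = 0.
  top-coefficients-zero : ∀ {k} (v : Vector r) → (∀ i → v (enum R i) ≡ 0ℤ) →
    (K : Fin k → Fin ∣ Q ∣) → Independent (col B ∘ K) → (c₁ : Vector k) (c₂ : Vector a') →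
    (∀ i → v i +ℤ lincomb (colN ∘ enum Q ∘ K) c₁ i +ℤ lincomb (colN ∘ Zδ) c₂ i ≡ 0ℤ) → ∀ l → c₁ l ≡ 0ℤ
  top-coefficients-zero v v-top K ind c₁ c₂ h = ind c₁ λ i →
    trans (sym (trans (cong₂ (λ p q → p +ℤ lincomb (col B ∘ K) c₁ i +ℤ q) (v-top i) (δ-top i)) (unpad _)))
          (h (enum R i))
    where
    δ-top : ∀ i → lincomb (colN ∘ Zδ) c₂ (enum R i) ≡ 0ℤ
    δ-top i = sumᶠ-zero {a'} (λ y → trans (cong (_* c₂ y) (top-zero i (δ y))) (*-zeroˡ (c₂ y)))
    unpad : ∀ x → 0ℤ +ℤ x +ℤ 0ℤ ≡ x
    unpad = solve-∀

  drop-middle : ∀ {k} (v : Vector r) (K : Fin k → Fin ∣ Q ∣) (c₁ : Vector k) (c₂ : Vector a') →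
    (∀ l → c₁ l ≡ 0ℤ) →
    (∀ i → v i +ℤ lincomb (colN ∘ enum Q ∘ K) c₁ i +ℤ lincomb (colN ∘ Zδ) c₂ i ≡ 0ℤ) →
    ∀ i → v i +ℤ lincomb (colN ∘ Zδ) c₂ i ≡ 0ℤ
  drop-middle v K c₁ c₂ c₁≡0 h i =
    trans (cong (_+ℤ lincomb (colN ∘ Zδ) c₂ i) (sym (+-identityʳ (v i))))
          (trans (cong (λ p → v i +ℤ p +ℤ lincomb (colN ∘ Zδ) c₂ i) (sym (lincomb-zeroʳ (colN ∘ enum Q ∘ K) c₁≡0 i)))
                 (h i))

  with-βδ : Vector r → Family (suc (rQ ℕ.+ a')) r
  with-βδ w zero = w
  with-βδ w (suc x) = append (colN ∘ enum Q ∘ β) (colN ∘ Zδ) x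

  dependent⇒inSpan-δ : (w : Vector r) → (∀ i → w (enum R i) ≡ 0ℤ) → Dependent (with-βδ w) → InSpan w (colN ∘ Zδ)
  dependent⇒inSpan-δ w w-top (c , (j₀ , c≢0) , h) = by-cases (c zero ℤ.≟ 0ℤ)
    where
    c₁ : Vector rQ
    c₁ l = c (suc (l ↑ˡ a'))
    c₂ : Vector a'
    c₂ y = c (suc (rQ ↑ʳ y))
    X₁ : Vector r
    X₁ = lincomb (colN ∘ enum Q ∘ β) c₁
    X₂ : Vector r
    X₂ = lincomb (colN ∘ Zδ) c₂
    h₃ : ∀ i → w i * c zero +ℤ X₁ i +ℤ X₂ i ≡ 0ℤ
    h₃ i = trans (+-assoc (w i * c zero) (X₁ i) (X₂ i))
                 (trans (cong (w i * c zero +ℤ_) (sym (lincomb-append (colN ∘ enum Q ∘ β) (colN ∘ Zδ) (c ∘ suc) i))) (h i))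
    c₁≡0 : ∀ l → c₁ l ≡ 0ℤ
    c₁≡0 = top-coefficients-zero (λ i → w i * c zero) (λ i → trans (cong (_* c zero) (w-top i)) (*-zeroˡ (c zero)))
                                 β β-independent c₁ c₂ h₃
    relation : ∀ i → w i * c zero +ℤ X₂ i ≡ 0ℤ
    relation = drop-middle (λ i → w i * c zero) β c₁ c₂ c₁≡0 h₃
    by-cases : Dec (c zero ≡ 0ℤ) → InSpan w (colN ∘ Zδ)
    by-cases (yes c0≡0) = ⊥-elim (c≢0 (c≡0 j₀))
      where
      c₂≡0 : ∀ y → c₂ y ≡ 0ℤ
      c₂≡0 = δ-independent c₂ (λ i → trans (sym (trans (cong (_+ℤ X₂ i) (trans (cong (w i *_) c0≡0) (*-zeroʳ (w i))))
                                                        (+-identityˡ (X₂ i))))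
                                           (relation i))
      c≡0 : ∀ x → c x ≡ 0ℤ
      c≡0 zero = c0≡0
      c≡0 (suc x) = all-↑-zero {rQ} {a'} (c ∘ suc) c₁≡0 c₂≡0 x
    by-cases (no c0≢0) = c zero , c0≢0 , (λ y → - c₂ y) , λ i →
      trans (*-comm (c zero) (w i)) (trans (+≡0⇒≡- (w i * c zero) (X₂ i) (relation i)) (sym (lincomb-neg (colN ∘ Zδ) c₂ i)))

  -- w, the columns β of Q and the columns δ of ∁Q are 1 + rk N vectors in the column space of N.
  topZero⇒inSpan-δ : (w : Vector r) → (∀ i → w (enum R i) ≡ 0ℤ) → InSpan w (colN ∘ ψ) → InSpan w (colN ∘ Zδ)
  topZero⇒inSpan-δ w w-top w-span =
    dependent⇒inSpan-δ w w-top (steinitz (with-βδ w) (colN ∘ ψ) spans (s≤s (ℕP.≤-reflexive a≡rQ+a')))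
    where
    spans : ∀ x → InSpan (with-βδ w x) (colN ∘ ψ)
    spans zero = w-span
    spans (suc x) = append-all (λ v → InSpan v (colN ∘ ψ)) (colN ∘ enum Q ∘ β) (colN ∘ Zδ)
                               (λ l → ψ-spans (enum Q (β l))) (λ y → ψ-spans (Zδ y)) x

  module _ (T : Subset ∣ Q ∣) (S : Subset m)
           (S-on-Q : ∀ t → lookup S (enum Q t) ≡ lookup T t)
           (S-⊇-∁Q : ∀ k → lookup S (enum (∁ Q) k) ≡ true)
           {d e : ℕ} (basisT : Basis (col (cols T B)) d) (rankS : Rank (cols S N) e) where

    τ : Fin d → Fin ∣ T ∣
    τ = proj₁ basisT
    τ-injective : Inj τ
    τ-injective = proj₁ (proj₂ basisT)
    τ-independent : Independent (col (cols T B) ∘ τ)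
    τ-independent = proj₁ (proj₂ (proj₂ basisT))
    τ-spans : ∀ u → InSpan (col (cols T B) u) (col (cols T B) ∘ τ)
    τ-spans = proj₂ (proj₂ (proj₂ basisT))

    Zτ : Fin d → Fin m
    Zτ l = enum Q (enum T (τ l))

    W : Family (d ℕ.+ a') r
    W = append (colN ∘ Zτ) (colN ∘ Zδ)

    W-independent : Independent W
    W-independent c h = all-↑-zero {d} {a'} c c₁≡0 c₂≡0
      where
      c₁ : Vector d
      c₁ l = c (l ↑ˡ a')
      c₂ : Vector a'
      c₂ y = c (d ↑ʳ y)
      h₀ : ∀ i → 0ℤ +ℤ lincomb (colN ∘ enum Q ∘ enum T ∘ τ) c₁ i +ℤ lincomb (colN ∘ Zδ) c₂ i ≡ 0ℤ
      h₀ i = trans (cong (_+ℤ lincomb (colN ∘ Zδ) c₂ i) (+-identityˡ (lincomb (colN ∘ Zτ) c₁ i)))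
                   (trans (sym (lincomb-append (colN ∘ Zτ) (colN ∘ Zδ) c i)) (h i))
      c₁≡0 : ∀ l → c₁ l ≡ 0ℤ
      c₁≡0 = top-coefficients-zero (λ _ → 0ℤ) (λ _ → refl) (enum T ∘ τ) τ-independent c₁ c₂ h₀
      c₂≡0 : ∀ y → c₂ y ≡ 0ℤ
      c₂≡0 = δ-independent c₂ (λ i → trans (sym (+-identityˡ (lincomb (colN ∘ Zδ) c₂ i)))
                                          (drop-middle (λ _ → 0ℤ) (enum T ∘ τ) c₁ c₂ c₁≡0 h₀ i))

    rank-≥ : d ℕ.+ a' ≤ e
    rank-≥ = independentIn⇒≤rank N S rankS (append Zτ Zδ) Z-injective Z-in-S
      (independent-cong (λ x i → sym (cong (λ v → v i) (append-map colN Zτ Zδ x))) W-independent)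
      where
      Z-injective : Inj (append Zτ Zδ)
      Z-injective = append-injective Zτ Zδ (λ e → τ-injective (enum-injective T (enum-injective Q e)))
                                     (λ e → δ-injective (enum-injective (∁ Q) e))
                                     (λ l y → enum≢enum∁ Q (enum T (τ l)) (δ y))
      Z-in-S : ∀ x → lookup S (append Zτ Zδ x) ≡ true
      Z-in-S = append-all (λ j → lookup S j ≡ true) Zτ Zδ
                          (λ l → trans (S-on-Q (enum T (τ l))) (enum-lookup T (τ l))) (λ y → S-⊇-∁Q (δ y))

    -- If λ B_u = B^τ α then w = λ N_u − N^τ α vanishes on R, so it lies in the span of the δ columns.
    columnT-inSpan-W : ∀ u → InSpan (colN (enum Q (enum T u))) W
    columnT-inSpan-W u = from-B-span (τ-spans u)
      where
      j : Fin m
      j = enum Q (enum T u)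
      from-B-span : InSpan (col (cols T B) u) (col (cols T B) ∘ τ) → InSpan (colN j) W
      from-B-span (λ₁ , λ₁≢0 , α , h) = from-δ-span (topZero⇒inSpan-δ w w-top w-span)
        where
        C : Vector r
        C = lincomb (colN ∘ Zτ) α
        w : Vector r
        w i = λ₁ * N i j +ℤ - C i
        w-top : ∀ i → w (enum R i) ≡ 0ℤ
        w-top i = trans (cong (λ p → p +ℤ - C (enum R i)) (h i)) (+-inverseʳ (C (enum R i)))
        K : Family (suc d) r
        K zero = colN j
        K (suc l) = colN (Zτ l)
        γ : Vector (suc d)
        γ zero = λ₁
        γ (suc l) = - α l
        w-span : InSpan w (colN ∘ ψ)
        w-span = inSpan-cong {W = colN ∘ ψ} (λ i → cong₂ _+ℤ_ (*-comm (N i j) λ₁) (lincomb-neg (colN ∘ Zτ) α i))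
                   (lincomb-inSpan K (colN ∘ ψ) (λ { zero → ψ-spans j ; (suc l) → ψ-spans (Zτ l) }) γ)
        from-δ-span : InSpan w (colN ∘ Zδ) → InSpan (colN j) W
        from-δ-span (μ , μ≢0 , α' , hμ) = μ * λ₁ , *-nonzero μ λ₁ μ≢0 λ₁≢0 , append (λ l → μ * α l) α' , λ i → sym (begin
          lincomb W (append (λ l → μ * α l) α') i
            ≡⟨ lincomb-append (colN ∘ Zτ) (colN ∘ Zδ) (append (λ l → μ * α l) α') i ⟩
          lincomb (colN ∘ Zτ) (λ l → append (λ l → μ * α l) α' (l ↑ˡ a')) i
            +ℤ lincomb (colN ∘ Zδ) (λ y → append (λ l → μ * α l) α' (d ↑ʳ y)) i
            ≡⟨ cong₂ _+ℤ_ (lincomb-cong (colN ∘ Zτ) (append-↑ˡ {d} {a'} (λ l → μ * α l) α') i)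
                          (lincomb-cong (colN ∘ Zδ) (append-↑ʳ {d} {a'} (λ l → μ * α l) α') i) ⟩
          lincomb (colN ∘ Zτ) (λ l → μ * α l) i +ℤ lincomb (colN ∘ Zδ) α' i
            ≡⟨ cong₂ _+ℤ_ (lincomb-scale (colN ∘ Zτ) μ α i) (sym (hμ i)) ⟩
          μ * C i +ℤ μ * w i
            ≡⟨ sym (expand μ λ₁ (N i j) (C i)) ⟩
          μ * λ₁ * N i j ∎)
          where
          open ≡-Reasoning
          expand : ∀ μ l x c → μ * l * x ≡ μ * c +ℤ μ * (l * x +ℤ - c)
          expand = solve-∀

    rank-≤ : e ≤ d ℕ.+ a'
    rank-≤ = spannedBy⇒rank≤ N S rankS W W-spans
      where
      W-spans : ∀ j → lookup S j ≡ true → InSpan (colN j) W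
      W-spans j j∈S with enum-cover Q j
      ... | inj₂ (k , refl) = inSpan-appendʳ (colN ∘ Zτ) (colN ∘ Zδ) (δ-spans k)
      ... | inj₁ (t , refl) with lookup-enum T t (trans (sym (S-on-Q t)) j∈S)
      ... | (u , refl) = columnT-inSpan-W u

    rank-lift : e ≡ d ℕ.+ a'
    rank-lift = ℕP.≤-antisym rank-≤ rank-≥

∸2≤⇒∸≤2 : ∀ x y → x ∸ 2 ≤ y → x ∸ y ≤ 2
∸2≤⇒∸≤2 x y h = ℕP.m≤n+o⇒m∸n≤o x y (ℕP.≤-trans (ℕP.m≤n+m∸n x 2) (ℕP.≤-trans (ℕP.+-monoʳ-≤ 2 h) (ℕP.≤-reflexive (ℕP.+-comm 2 y))))

module Consequences {r m : ℕ} (A : Matrix r m) (Q : Subset m) (a a' : ℕ)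
  (rankA : Rank A a) (rankA∁Q : Rank (cols (∁ Q) A) a') (a'<a : a' < a)
  (P : Matrix r r) (P-invertible : Invertible P)
  (rankB : Rank (rows (initSeg r (a ∸ a')) (cols Q (P ⊗ A))) (a ∸ a'))
  (rank-top-right : Rank (rows (initSeg r (a ∸ a')) (cols (∁ Q) (P ⊗ A))) 0) where

  rQ : ℕ
  rQ = a ∸ a'
  R : Subset r
  R = initSeg r rQ
  N : Matrix r m
  N = P ⊗ A
  B : Matrix ∣ R ∣ ∣ Q ∣
  B = rows R (cols Q N)

  top-right-zero : ∀ i j → N (enum R i) (enum (∁ Q) j) ≡ 0ℤ
  top-right-zero = rank0⇒zero (rows R (cols (∁ Q) N)) rank-top-right

  rankN : Rank N a
  rankN = rank-invertible-⊗ P-invertible A rankA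

  rankN∁Q : Rank (cols (∁ Q) N) a'
  rankN∁Q = rank-invertible-⊗ P-invertible (cols (∁ Q) A) rankA∁Q

  a'≤a : a' ≤ a
  a'≤a = ℕP.<⇒≤ a'<a

  open BlockRank N Q R rQ a a' top-right-zero (rank-basis B rankB) (rank-basis N rankN)
                 (rank-basis (cols (∁ Q) N) rankN∁Q) (sym (ℕP.m∸n+n≡m a'≤a))
    using (rank-lift)

  rank-∁lift : (T' : Subset ∣ Q ∣) {T : Subset ∣ Q ∣} → (∀ t → not (lookup T' t) ≡ lookup T t) →
    ∀ {d e} → Rank (cols T B) d → Rank (cols (∁ (liftSubset Q T')) A) e → e ≡ d ℕ.+ a'
  rank-∁lift T' {T} T≡∁T' rankT rankS =
    rank-lift T (∁ (liftSubset Q T')) (λ t → trans (∁liftSubset-enum Q T' t) (T≡∁T' t)) (∁liftSubset-enum∁ Q T')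
              (rank-basis (cols T B) rankT) (rank-invertible-⊗ P-invertible (cols (∁ (liftSubset Q T')) A) rankS)

  rank-bottom-right : Rank (rows (∁ R) (cols (∁ Q) N)) (a ∸ rQ)
  rank-bottom-right = subst (Rank (rows (∁ R) (cols (∁ Q) N))) (sym (ℕP.m∸[m∸n]≡n a'≤a))
    (rank-relations (cols (∁ Q) N) (rows (∁ R) (cols (∁ Q) N))
      (λ f c h i → h (enum (∁ R) i))
      (λ f c h x → relation-lifts f c h x (enum-cover R x))
      rankN∁Q)
    where
    relation-lifts : ∀ {k} (f : Fin k → Fin ∣ ∁ Q ∣) (c : Vector k) →
      (∀ i → lincomb (col (rows (∁ R) (cols (∁ Q) N)) ∘ f) c i ≡ 0ℤ) → ∀ x →
      (Σ (Fin ∣ R ∣) λ k → enum R k ≡ x) ⊎ (Σ (Fin ∣ ∁ R ∣) λ k → enum (∁ R) k ≡ x) →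
      lincomb (col (cols (∁ Q) N) ∘ f) c x ≡ 0ℤ
    relation-lifts {k} f c h x (inj₁ (i , refl)) =
      sumᶠ-zero {k} (λ j → trans (cong (_* c j) (top-right-zero i (f j))) (*-zeroˡ (c j)))
    relation-lifts f c h x (inj₂ (i , refl)) = h i

  abundant-preserved : Abundant A → Abundant B
  abundant-preserved (k , rankA-k , _ , abundant) =
    rQ , rankB , ℕP.m<n⇒0<n∸m a'<a , λ T |T|≥ → rank-large-T T |T|≥ (rank-exists (cols T B))
    where
    rank-large-T : (T : Subset ∣ Q ∣) → ∣ Q ∣ ∸ 2 ≤ ∣ T ∣ → Σ ℕ (Rank (cols T B)) → Rank (cols T B) rQ
    rank-large-T T |T|≥ (d , rankT) = subst (Rank (cols T B)) d≡rQ rankT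
      where
      S : Subset m
      S = ∁ (liftSubset Q (∁ T))
      |S|≥ : m ∸ 2 ≤ ∣ S ∣
      |S|≥ = ℕP.≤-trans (ℕP.∸-monoʳ-≤ m (ℕP.≤-trans (ℕP.≤-reflexive (trans (liftSubset-card Q (∁ T)) (∣∁p∣≡n∸∣p∣ T)))
                                                   (∸2≤⇒∸≤2 ∣ Q ∣ ∣ T ∣ |T|≥)))
                        (ℕP.≤-reflexive (sym (∣∁p∣≡n∸∣p∣ (liftSubset Q (∁ T)))))
      a≡d+a' : a ≡ d ℕ.+ a'
      a≡d+a' = rank-∁lift (∁ T) (λ t → trans (cong not (lookup-∁ T t)) (not-involutive _)) rankT
                 (subst (Rank (cols S A)) (rank-unique A rankA-k rankA) (abundant S |S|≥))
      d≡rQ : d ≡ rQ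
      d≡rQ = trans (sym (ℕP.m+n∸n≡m d a')) (cong (_∸ a') (sym a≡d+a'))

  solution-restricts : (b : Vector r) (x : Vector m) → Sol A b x → Sol B (restrict R (P · b)) (restrict Q x)
  solution-restricts b x sol i = begin
    (B · restrict Q x) i
      ≡⟨ sym (+-identityʳ ((B · restrict Q x) i)) ⟩
    (B · restrict Q x) i +ℤ 0ℤ
      ≡⟨ cong ((B · restrict Q x) i +ℤ_) (sym (sumᶠ-zero {∣ ∁ Q ∣} (λ j → trans (cong (_* x (enum (∁ Q) j)) (top-right-zero i j))
                                                                               (*-zeroˡ (x (enum (∁ Q) j)))))) ⟩
    (B · restrict Q x) i +ℤ sumᶠ (λ j → N (enum R i) (enum (∁ Q) j) * x (enum (∁ Q) j))
      ≡⟨ sym (sumᶠ-split Q (λ j → N (enum R i) j * x j)) ⟩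
    (N · x) (enum R i)
      ≡⟨ ⊗·-assoc P A x (enum R i) ⟩
    (P · (A · x)) (enum R i)
      ≡⟨ ·-cong P sol (enum R i) ⟩
    (P · b) (enum R i) ∎
    where open ≡-Reasoning

  positive-preserved : Positive A → Positive B
  positive-preserved (x , sol , x≥1) =
    restrict Q x ,
    (λ i → trans (solution-restricts (λ _ → 0ℤ) x sol i) (·-zeroʳ P (λ _ → 0ℤ) (λ _ → refl) (enum R i))) ,
    (λ j → x≥1 (enum Q j))

  rQ-lift : (Q' : Subset ∣ Q ∣) → Σ (Subset m) λ Q'' → Q'' ⊆ Q × ∣ Q'' ∣ ≡ ∣ Q' ∣
                 × ((k k' : ℕ) → RQ A Q'' k → RQ B Q' k' → k ≡ k')
  rQ-lift Q' = liftSubset Q Q' , liftSubset-⊆ Q Q' , liftSubset-card Q Q' , rQ≡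
    where
    rQ≡ : (k k' : ℕ) → RQ A (liftSubset Q Q') k → RQ B Q' k' → k ≡ k'
    rQ≡ k k' (a₀ , a₀' , rankA₀ , rankA₀' , k≡) (b₀ , b₀' , rankB₀ , rankB₀' , k'≡) = begin
      k                  ≡⟨ k≡ ⟩
      a₀ ∸ a₀'           ≡⟨ cong₂ _∸_ (rank-unique A rankA₀ rankA)
                                      (rank-∁lift Q' (λ t → sym (lookup-∁ Q' t)) rankB₀' rankA₀') ⟩
      a ∸ (b₀' ℕ.+ a')   ≡⟨ cong (a ∸_) (ℕP.+-comm b₀' a') ⟩
      a ∸ (a' ℕ.+ b₀')   ≡⟨ sym (ℕP.∸-+-assoc a a' b₀') ⟩
      rQ ∸ b₀'           ≡⟨ cong (_∸ b₀') (rank-unique B rankB rankB₀) ⟩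
      b₀ ∸ b₀'           ≡⟨ sym k'≡ ⟩
      k' ∎
      where open ≡-Reasoning

-- Row reduction over ℤ

vec2 : ℤ → ℤ → Vector 2
vec2 a b zero = a
vec2 a b (suc zero) = b

mat2 : ℤ → ℤ → ℤ → ℤ → Matrix 2 2
mat2 p q r s zero zero = p
mat2 p q r s zero (suc zero) = q
mat2 p q r s (suc zero) zero = r
mat2 p q r s (suc zero) (suc zero) = s

euclid-2×2 : (fuel : ℕ) (a b : ℤ) → ℤ.∣ b ∣ < fuel → Σ (Matrix 2 2) λ M → Invertible M × (M · vec2 a b) (suc zero) ≡ 0ℤ
euclid-2×2 (suc fuel) a b |b|<fuel with b ℤ.≟ 0ℤ
... | yes b≡0 = idMat 2 , idMat-invertible , trans (idMat-· (vec2 a b) (suc zero)) b≡0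
... | no b≢0 = from-remainder (euclid-2×2 fuel b (+ ρ) ρ<fuel)
  where
  q : ℤ
  q = _/_ a b {{ℤ.≢-nonZero b≢0}}
  ρ : ℕ
  ρ = _%_ a b {{ℤ.≢-nonZero b≢0}}
  ρ<fuel : ρ < fuel
  ρ<fuel = ℕP.<-≤-trans (n%d<d a b {{ℤ.≢-nonZero b≢0}}) (ℕP.≤-pred |b|<fuel)
  division : a ≡ + ρ +ℤ q * b
  division = a≡a%n+[a/n]*n a b {{ℤ.≢-nonZero b≢0}}
  -- E is one Euclidean step (a, b) ↦ (b, a mod b); E′ is its inverse.
  E : Matrix 2 2
  E = mat2 0ℤ 1ℤ 1ℤ (- q)
  E′ : Matrix 2 2
  E′ = mat2 q 1ℤ 1ℤ 0ℤ
  E⊗E′ : ∀ i j → (E ⊗ E′) i j ≡ idMat 2 i j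
  E⊗E′ zero zero = entry q
    where entry : ∀ q → 0ℤ * q +ℤ (1ℤ * 1ℤ +ℤ 0ℤ) ≡ 1ℤ
          entry = solve-∀
  E⊗E′ zero (suc zero) = entry q
    where entry : ∀ q → 0ℤ * 1ℤ +ℤ (1ℤ * 0ℤ +ℤ 0ℤ) ≡ 0ℤ
          entry = solve-∀
  E⊗E′ (suc zero) zero = entry q
    where entry : ∀ q → 1ℤ * q +ℤ (- q * 1ℤ +ℤ 0ℤ) ≡ 0ℤ
          entry = solve-∀
  E⊗E′ (suc zero) (suc zero) = entry q
    where entry : ∀ q → 1ℤ * 1ℤ +ℤ (- q * 0ℤ +ℤ 0ℤ) ≡ 1ℤ
          entry = solve-∀
  E′⊗E : ∀ i j → (E′ ⊗ E) i j ≡ idMat 2 i j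
  E′⊗E zero zero = entry q
    where entry : ∀ q → q * 0ℤ +ℤ (1ℤ * 1ℤ +ℤ 0ℤ) ≡ 1ℤ
          entry = solve-∀
  E′⊗E zero (suc zero) = entry q
    where entry : ∀ q → q * 1ℤ +ℤ (1ℤ * - q +ℤ 0ℤ) ≡ 0ℤ
          entry = solve-∀
  E′⊗E (suc zero) zero = entry q
    where entry : ∀ q → 1ℤ * 0ℤ +ℤ (0ℤ * 1ℤ +ℤ 0ℤ) ≡ 0ℤ
          entry = solve-∀
  E′⊗E (suc zero) (suc zero) = entry q
    where entry : ∀ q → 1ℤ * 1ℤ +ℤ (0ℤ * - q +ℤ 0ℤ) ≡ 1ℤ
          entry = solve-∀
  E-step : ∀ i → (E · vec2 a b) i ≡ vec2 b (+ ρ) i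
  E-step zero = entry a b
    where entry : ∀ a b → 0ℤ * a +ℤ (1ℤ * b +ℤ 0ℤ) ≡ b
          entry = solve-∀
  E-step (suc zero) = trans (cong (λ x → 1ℤ * x +ℤ (- q * b +ℤ 0ℤ)) division) (entry (+ ρ) q b)
    where entry : ∀ p q b → 1ℤ * (p +ℤ q * b) +ℤ (- q * b +ℤ 0ℤ) ≡ p
          entry = solve-∀
  from-remainder : Σ (Matrix 2 2) (λ M → Invertible M × (M · vec2 b (+ ρ)) (suc zero) ≡ 0ℤ) →
       Σ (Matrix 2 2) (λ M → Invertible M × (M · vec2 a b) (suc zero) ≡ 0ℤ)
  from-remainder (M , M-invertible , M-clears) = M ⊗ E , ⊗-invertible {P = M} {Q = E} M-invertible (E′ , E⊗E′ , E′⊗E) ,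
    trans (⊗·-assoc M E (vec2 a b) (suc zero)) (trans (·-cong M E-step (suc zero)) M-clears)

idMat-≢ : ∀ {n} (i k : Fin n) → ¬ i ≡ k → idMat n i k ≡ 0ℤ
idMat-≢ zero zero ne = ⊥-elim (ne refl)
idMat-≢ zero (suc k) ne = refl
idMat-≢ (suc i) zero ne = refl
idMat-≢ (suc i) (suc k) ne = idMat-≢ i k (λ e → ne (cong suc e))

1⊕ : ∀ {n} → Matrix n n → Matrix (suc n) (suc n)
1⊕ U zero zero = 1ℤ
1⊕ U zero (suc k) = 0ℤ
1⊕ U (suc i) zero = 0ℤ
1⊕ U (suc i) (suc k) = U i k

1⊕-·-zero : ∀ {n} (U : Matrix n n) (v : Vector (suc n)) → (1⊕ U · v) zero ≡ v zero
1⊕-·-zero {n} U v = trans (cong (1ℤ * v zero +ℤ_) (sumᶠ-zero {n} (λ k → *-zeroˡ (v (suc k))))) (trans (+-identityʳ _) (*-identityˡ _))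

1⊕-·-suc : ∀ {n} (U : Matrix n n) (v : Vector (suc n)) i → (1⊕ U · v) (suc i) ≡ (U · (v ∘ suc)) i
1⊕-·-suc U v i = trans (cong (_+ℤ (U · (v ∘ suc)) i) (*-zeroˡ (v zero))) (+-identityˡ _)

1⊕-⊗ : ∀ {n} (U U' : Matrix n n) → ∀ i j → (1⊕ U ⊗ 1⊕ U') i j ≡ 1⊕ (U ⊗ U') i j
1⊕-⊗ U U' zero zero = 1⊕-·-zero U (λ k → 1⊕ U' k zero)
1⊕-⊗ U U' zero (suc j) = 1⊕-·-zero U (λ k → 1⊕ U' k (suc j))
1⊕-⊗ {n} U U' (suc i) zero = trans (1⊕-·-suc U (λ k → 1⊕ U' k zero) i) (sumᶠ-zero {n} (λ k → *-zeroʳ (U i k)))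
1⊕-⊗ U U' (suc i) (suc j) = 1⊕-·-suc U (λ k → 1⊕ U' k (suc j)) i

1⊕-idMat : ∀ {n} → ∀ i j → 1⊕ (idMat n) i j ≡ idMat (suc n) i j
1⊕-idMat zero zero = refl
1⊕-idMat zero (suc j) = refl
1⊕-idMat (suc i) zero = refl
1⊕-idMat (suc i) (suc j) = refl

1⊕-cong : ∀ {n} {U U' : Matrix n n} → (∀ i j → U i j ≡ U' i j) → ∀ i j → 1⊕ U i j ≡ 1⊕ U' i j
1⊕-cong h zero zero = refl
1⊕-cong h zero (suc j) = refl
1⊕-cong h (suc i) zero = refl
1⊕-cong h (suc i) (suc j) = h i j

IdentityOutside : ∀ {n} → ℕ → Matrix n n → Set
IdentityOutside {n} t U = ∀ i k → (t ≤ toℕ i ⊎ t ≤ toℕ k) → U i k ≡ idMat n i k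

InvertibleIn : ∀ {n} → ℕ → Matrix n n → Set
InvertibleIn {n} t U = IdentityOutside t U × Σ (Matrix n n) λ U' → IdentityOutside t U' ×
  (∀ i j → (U ⊗ U') i j ≡ idMat n i j) × (∀ i j → (U' ⊗ U) i j ≡ idMat n i j)

invertibleIn⇒invertible : ∀ {n t} {U : Matrix n n} → InvertibleIn t U → Invertible U
invertibleIn⇒invertible (_ , U' , _ , h1 , h2) = U' , h1 , h2

IdentityOutside-idMat : ∀ {n} t → IdentityOutside t (idMat n)
IdentityOutside-idMat t i k _ = refl

IdentityOutside-·-outside : ∀ {n t} {U : Matrix n n} → IdentityOutside t U → (v : Vector n) → ∀ i → t ≤ toℕ i → (U · v) i ≡ v i
IdentityOutside-·-outside {n} {U = U} bt v i le = trans (sumᶠ-cong (λ k → cong (_* v k) (bt i k (inj₁ le)))) (sumᶠ-idMatˡ i v)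

IdentityOutside-·-preserves-zero : ∀ {n t} {U : Matrix n n} → IdentityOutside t U → (v : Vector n) → (∀ k → toℕ k < t → v k ≡ 0ℤ) →
  ∀ i → toℕ i < t → (U · v) i ≡ 0ℤ
IdentityOutside-·-preserves-zero {n} {t} {U} bt v hv i lt = sumᶠ-zero {n} term
  where
  term : ∀ k → U i k * v k ≡ 0ℤ
  term k with toℕ k ℕP.<? t
  ... | yes kt = trans (cong (U i k *_) (hv k kt)) (*-zeroʳ (U i k))
  ... | no kt = trans (cong (_* v k) (trans (bt i k (inj₂ (ℕP.≮⇒≥ kt))) (idMat-≢ i k ne))) (*-zeroˡ (v k))
    where ne : ¬ i ≡ k
          ne refl = kt lt

IdentityOutside-⊗ : ∀ {n t} {U V : Matrix n n} → IdentityOutside t U → IdentityOutside t V → IdentityOutside t (U ⊗ V)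
IdentityOutside-⊗ {n} {U = U} {V} bu bv i k (inj₁ le) = trans (IdentityOutside-·-outside bu (λ l → V l k) i le) (bv i k (inj₁ le))
IdentityOutside-⊗ {n} {U = U} {V} bu bv i k (inj₂ le) = trans (sumᶠ-cong (λ l → cong (U i l *_) (bv l k (inj₂ le)))) (trans (sumᶠ-idMatʳ k (U i)) (bu i k (inj₂ le)))

IdentityOutside-1⊕ : ∀ {n t} {U : Matrix n n} → IdentityOutside t U → IdentityOutside (suc t) (1⊕ U)
IdentityOutside-1⊕ bt zero zero (inj₁ ())
IdentityOutside-1⊕ bt zero zero (inj₂ ())
IdentityOutside-1⊕ bt zero (suc k) _ = refl
IdentityOutside-1⊕ bt (suc i) zero _ = refl
IdentityOutside-1⊕ bt (suc i) (suc k) (inj₁ (s≤s le)) = bt i k (inj₁ le)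
IdentityOutside-1⊕ bt (suc i) (suc k) (inj₂ (s≤s le)) = bt i k (inj₂ le)

InvertibleIn-idMat : ∀ {n} t → InvertibleIn t (idMat n)
InvertibleIn-idMat {n} t = IdentityOutside-idMat t , idMat n , IdentityOutside-idMat t , idMat-⊗ (idMat n) , idMat-⊗ (idMat n)

InvertibleIn-⊗ : ∀ {n t} {U V : Matrix n n} → InvertibleIn t U → InvertibleIn t V → InvertibleIn t (U ⊗ V)
InvertibleIn-⊗ {U = U} {V} (bu , U' , bu' , u1 , u2) (bv , V' , bv' , v1 , v2) =
  IdentityOutside-⊗ bu bv , V' ⊗ U' , IdentityOutside-⊗ bv' bu' , proj₁ (proj₂ iv) , proj₂ (proj₂ iv)
  where iv = ⊗-invertible {P = U} {Q = V} (U' , u1 , u2) (V' , v1 , v2)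

InvertibleIn-1⊕ : ∀ {n t} {U : Matrix n n} → InvertibleIn t U → InvertibleIn (suc t) (1⊕ U)
InvertibleIn-1⊕ {n} {U = U} (bt , U' , bt' , h1 , h2) = IdentityOutside-1⊕ bt , 1⊕ U' , IdentityOutside-1⊕ bt' ,
  (λ i j → trans (1⊕-⊗ U U' i j) (trans (1⊕-cong h1 i j) (1⊕-idMat i j))) ,
  (λ i j → trans (1⊕-⊗ U' U i j) (trans (1⊕-cong h2 i j) (1⊕-idMat i j)))

embed2 : ∀ {n} → Matrix 2 2 → Matrix (suc (suc n)) (suc (suc n))
embed2 M zero zero = M zero zero
embed2 M zero (suc zero) = M zero (suc zero)
embed2 M zero (suc (suc k)) = 0ℤ
embed2 M (suc zero) zero = M (suc zero) zero
embed2 M (suc zero) (suc zero) = M (suc zero) (suc zero)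
embed2 M (suc zero) (suc (suc k)) = 0ℤ
embed2 M (suc (suc i)) zero = 0ℤ
embed2 M (suc (suc i)) (suc zero) = 0ℤ
embed2 M (suc (suc i)) (suc (suc k)) = idMat _ i k

embed2-·-one : ∀ {n} (M : Matrix 2 2) (u : Vector (suc (suc n))) → (embed2 M · u) (suc zero) ≡ (M · vec2 (u zero) (u (suc zero))) (suc zero)
embed2-·-one {n} M u = cong (λ x → M (suc zero) zero * u zero +ℤ (M (suc zero) (suc zero) * u (suc zero) +ℤ x))
  (sumᶠ-zero {n} (λ k → *-zeroˡ (u (suc (suc k)))))

embed2-·-suc-suc : ∀ {n} (M : Matrix 2 2) (u : Vector (suc (suc n))) i → (embed2 M · u) (suc (suc i)) ≡ u (suc (suc i))
embed2-·-suc-suc {n} M u i = trans (cong₂ (λ x y → x +ℤ (y +ℤ sumᶠ (λ k → idMat n i k * u (suc (suc k))))) (*-zeroˡ (u zero)) (*-zeroˡ (u (suc zero))))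
  (trans (+-identityˡ _) (trans (+-identityˡ _) (sumᶠ-idMatˡ i (λ k → u (suc (suc k))))))

embed2-⊗ : ∀ {n} (M M' : Matrix 2 2) → ∀ i j → (embed2 {n} M ⊗ embed2 M') i j ≡ embed2 (M ⊗ M') i j
embed2-⊗ {n} M M' = entry
  where
  z : ∀ {a b : ℤ} → a ≡ 0ℤ → b ≡ 0ℤ → ∀ c → a +ℤ (b +ℤ c) ≡ c
  z refl refl c = trans (+-identityˡ _) (+-identityˡ _)
  entry : ∀ i j → (embed2 {n} M ⊗ embed2 M') i j ≡ embed2 (M ⊗ M') i j
  entry zero zero = cong (λ x → M zero zero * M' zero zero +ℤ (M zero (suc zero) * M' (suc zero) zero +ℤ x)) (sumᶠ-zero {n} (λ k → *-zeroˡ 0ℤ))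
  entry zero (suc zero) = cong (λ x → M zero zero * M' zero (suc zero) +ℤ (M zero (suc zero) * M' (suc zero) (suc zero) +ℤ x)) (sumᶠ-zero {n} (λ k → *-zeroˡ 0ℤ))
  entry (suc zero) zero = cong (λ x → M (suc zero) zero * M' zero zero +ℤ (M (suc zero) (suc zero) * M' (suc zero) zero +ℤ x)) (sumᶠ-zero {n} (λ k → *-zeroˡ 0ℤ))
  entry (suc zero) (suc zero) = cong (λ x → M (suc zero) zero * M' zero (suc zero) +ℤ (M (suc zero) (suc zero) * M' (suc zero) (suc zero) +ℤ x)) (sumᶠ-zero {n} (λ k → *-zeroˡ 0ℤ))
  entry zero (suc (suc j)) = trans (z (*-zeroʳ (M zero zero)) (*-zeroʳ (M zero (suc zero))) _) (sumᶠ-zero {n} (λ k → *-zeroˡ (idMat n k j)))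
  entry (suc zero) (suc (suc j)) = trans (z (*-zeroʳ (M (suc zero) zero)) (*-zeroʳ (M (suc zero) (suc zero))) _) (sumᶠ-zero {n} (λ k → *-zeroˡ (idMat n k j)))
  entry (suc (suc i)) zero = trans (z (*-zeroˡ (M' zero zero)) (*-zeroˡ (M' (suc zero) zero)) _) (sumᶠ-zero {n} (λ k → *-zeroʳ (idMat n i k)))
  entry (suc (suc i)) (suc zero) = trans (z (*-zeroˡ (M' zero (suc zero))) (*-zeroˡ (M' (suc zero) (suc zero))) _) (sumᶠ-zero {n} (λ k → *-zeroʳ (idMat n i k)))
  entry (suc (suc i)) (suc (suc j)) = trans (z (*-zeroˡ 0ℤ) (*-zeroˡ 0ℤ) _) (sumᶠ-idMatˡ i (λ k → idMat n k j))

embed2-idMat : ∀ {n} → ∀ i j → embed2 {n} (idMat 2) i j ≡ idMat (suc (suc n)) i j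
embed2-idMat zero zero = refl
embed2-idMat zero (suc zero) = refl
embed2-idMat zero (suc (suc j)) = refl
embed2-idMat (suc zero) zero = refl
embed2-idMat (suc zero) (suc zero) = refl
embed2-idMat (suc zero) (suc (suc j)) = refl
embed2-idMat (suc (suc i)) zero = refl
embed2-idMat (suc (suc i)) (suc zero) = refl
embed2-idMat (suc (suc i)) (suc (suc j)) = refl

embed2-cong : ∀ {n} {M M' : Matrix 2 2} → (∀ i j → M i j ≡ M' i j) → ∀ i j → embed2 {n} M i j ≡ embed2 M' i j
embed2-cong h zero zero = h zero zero
embed2-cong h zero (suc zero) = h zero (suc zero)
embed2-cong h zero (suc (suc j)) = refl
embed2-cong h (suc zero) zero = h (suc zero) zero
embed2-cong h (suc zero) (suc zero) = h (suc zero) (suc zero)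
embed2-cong h (suc zero) (suc (suc j)) = refl
embed2-cong h (suc (suc i)) zero = refl
embed2-cong h (suc (suc i)) (suc zero) = refl
embed2-cong h (suc (suc i)) (suc (suc j)) = refl

IdentityOutside-embed2 : ∀ {n} t (M : Matrix 2 2) → IdentityOutside (suc (suc t)) (embed2 {n} M)
IdentityOutside-embed2 t M zero zero (inj₁ ())
IdentityOutside-embed2 t M zero zero (inj₂ ())
IdentityOutside-embed2 t M zero (suc zero) (inj₁ ())
IdentityOutside-embed2 t M zero (suc zero) (inj₂ (s≤s ()))
IdentityOutside-embed2 t M zero (suc (suc k)) _ = refl
IdentityOutside-embed2 t M (suc zero) zero (inj₁ (s≤s ()))
IdentityOutside-embed2 t M (suc zero) zero (inj₂ ())
IdentityOutside-embed2 t M (suc zero) (suc zero) (inj₁ (s≤s ()))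
IdentityOutside-embed2 t M (suc zero) (suc zero) (inj₂ (s≤s ()))
IdentityOutside-embed2 t M (suc zero) (suc (suc k)) _ = refl
IdentityOutside-embed2 t M (suc (suc i)) zero _ = refl
IdentityOutside-embed2 t M (suc (suc i)) (suc zero) _ = refl
IdentityOutside-embed2 t M (suc (suc i)) (suc (suc k)) _ = refl

InvertibleIn-embed2 : ∀ {n} t {M : Matrix 2 2} → Invertible M → InvertibleIn (suc (suc t)) (embed2 {n} M)
InvertibleIn-embed2 t {M} (M' , h1 , h2) = IdentityOutside-embed2 t M , embed2 M' , IdentityOutside-embed2 t M' ,
  (λ i j → trans (embed2-⊗ M M' i j) (trans (embed2-cong h1 i j) (embed2-idMat i j))) ,
  (λ i j → trans (embed2-⊗ M' M i j) (trans (embed2-cong h2 i j) (embed2-idMat i j)))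

ClearsColumn : ∀ {n} → ℕ → Matrix n n → Vector n → Set
ClearsColumn t V v = ∀ i → 1 ≤ toℕ i → toℕ i < suc t → (V · v) i ≡ 0ℤ

-- Entries 2, …, t are cleared recursively by a matrix acting on rows 1, …, t; then the Euclidean
-- algorithm on entries 0 and 1 clears entry 1.
clear-column : ∀ {n} t → suc t ≤ n → (v : Vector n) → Σ (Matrix n n) λ V → InvertibleIn (suc t) V × ClearsColumn t V v
clear-column {n} zero _ v = idMat n , InvertibleIn-idMat 1 , λ { zero () _ ; (suc i) _ (s≤s ()) }
clear-column {suc (suc n)} (suc t) (s≤s (s≤s t≤n)) v with clear-column t (s≤s t≤n) (v ∘ suc)
... | (W , W-invertible , W-clears) = combine (euclid-2×2 (suc ℤ.∣ u (suc zero) ∣) (u zero) (u (suc zero)) ℕP.≤-refl)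
  where
  u : Vector (suc (suc n))
  u = 1⊕ W · v
  combine : (Σ (Matrix 2 2) λ M → Invertible M × (M · vec2 (u zero) (u (suc zero))) (suc zero) ≡ 0ℤ) →
            Σ (Matrix (suc (suc n)) (suc (suc n))) λ V → InvertibleIn (suc (suc t)) V × ClearsColumn (suc t) V v
  combine (M , M-invertible , M-clears) =
    embed2 M ⊗ 1⊕ W , InvertibleIn-⊗ (InvertibleIn-embed2 t M-invertible) (InvertibleIn-1⊕ W-invertible) , clears
    where
    clears : ClearsColumn (suc t) (embed2 M ⊗ 1⊕ W) v
    clears zero () _
    clears (suc zero) _ _ = trans (⊗·-assoc (embed2 M) (1⊕ W) v (suc zero)) (trans (embed2-·-one M u) M-clears)
    clears (suc (suc i)) _ (s≤s (s≤s i<t)) = trans (⊗·-assoc (embed2 M) (1⊕ W) v (suc (suc i)))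
      (trans (embed2-·-suc-suc M u i) (trans (1⊕-·-suc W v (suc i)) (W-clears (suc i) (s≤s z≤n) (s≤s i<t))))

-- U only mixes the first t rows; among them, the rows s, …, t − 1 of U G vanish and the first s rows
-- are independent on the pivot columns.
record Echelon {n c} (t : ℕ) (G : Matrix n c) : Set where
  constructor echelonForm
  field
    U : Matrix n n
    U-invertible : InvertibleIn t U
    s : ℕ
    s≤t : s ≤ t
    rows-zero : ∀ i → s ≤ toℕ i → toℕ i < t → ∀ j → (U ⊗ G) i j ≡ 0ℤ
    pivot : Fin s → Fin c
    pivot-injective : Inj pivot
    pivot-independent : Independent (λ l (i : Fin ∣ initSeg n s ∣) → (U ⊗ G) (enum (initSeg n s) i) (pivot l))

echelon-zero-column : ∀ {n c} t (G : Matrix n (suc c)) → (∀ i → toℕ i < t → G i zero ≡ 0ℤ) →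
  Echelon t (λ i j → G i (suc j)) → Echelon t G
echelon-zero-column t G column-zero (echelonForm U U-invertible s s≤t rows-zero π π-injective π-independent) =
  echelonForm U U-invertible s s≤t rows-zero' (suc ∘ π) (λ e → π-injective (suc-injective e)) π-independent
  where
  rows-zero' : ∀ i → s ≤ toℕ i → toℕ i < t → ∀ j → (U ⊗ G) i j ≡ 0ℤ
  rows-zero' i s≤i i<t zero = IdentityOutside-·-preserves-zero (proj₁ U-invertible) (λ k → G k zero) column-zero i i<t
  rows-zero' i s≤i i<t (suc j) = rows-zero i s≤i i<t j

find-nonzero : ∀ {n} t (v : Vector n) → ¬ (∀ i → toℕ i < t → v i ≡ 0ℤ) → Σ (Fin n) λ i → toℕ i < t × ¬ v i ≡ 0ℤ
find-nonzero {n} t v not-all-zero with ¬∀⟶∃¬ n _ (λ i → (toℕ i <? t) →-dec (v i ℤ.≟ 0ℤ)) not-all-zero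
... | (i , h) with toℕ i <? t
...   | yes i<t = i , i<t , (λ e → h (λ _ → e))
...   | no i≮t = ⊥-elim (h (λ i<t → ⊥-elim (i≮t i<t)))

-- The first column has a nonzero entry among the first t + 1 rows.  Clearing the entries 1, …, t of
-- that column by V leaves a nonzero pivot in the top-left corner, and an echelon form of the
-- remaining block (rows 1, …, t, columns 1, …) extends by one pivot.
module PivotStep {n c : ℕ} (t : ℕ) (G : Matrix (suc n) (suc c))
  (i₀ : Fin (suc n)) (i₀<t+1 : toℕ i₀ < suc t) (G-i₀≢0 : ¬ G i₀ zero ≡ 0ℤ)
  (V : Matrix (suc n) (suc n)) (V-invertible : InvertibleIn (suc t) V) (V-clears : ClearsColumn t V (λ i → G i zero)) where

  v : Vector (suc n)
  v i = G i zero

  H : Matrix (suc n) (suc c)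
  H = V ⊗ G

  H' : Matrix n c
  H' i j = H (suc i) (suc j)

  corner≢0 : ¬ H zero zero ≡ 0ℤ
  corner≢0 e = G-i₀≢0 (begin
    v i₀                   ≡⟨ sym (idMat-· v i₀) ⟩
    (idMat (suc n) · v) i₀ ≡⟨ sym (sumᶠ-cong (λ k → cong (_* v k) (V'⊗V i₀ k))) ⟩
    ((V' ⊗ V) · v) i₀      ≡⟨ ⊗·-assoc V' V v i₀ ⟩
    (V' · (V · v)) i₀      ≡⟨ IdentityOutside-·-preserves-zero V'-outside (V · v) Vv-zero i₀ i₀<t+1 ⟩
    0ℤ ∎)
    where
    open ≡-Reasoning
    V' = proj₁ (proj₂ V-invertible)
    V'-outside = proj₁ (proj₂ (proj₂ V-invertible))
    V'⊗V = proj₂ (proj₂ (proj₂ (proj₂ V-invertible)))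
    Vv-zero : ∀ k → toℕ k < suc t → (V · v) k ≡ 0ℤ
    Vv-zero zero _ = e
    Vv-zero (suc k) k<t+1 = V-clears (suc k) (s≤s z≤n) k<t+1

  extend : Echelon t H' → Echelon (suc t) G
  extend (echelonForm U' U'-invertible s' s'≤t rows-zero' π' π'-injective π'-independent) =
    echelonForm (1⊕ U' ⊗ V) (InvertibleIn-⊗ (InvertibleIn-1⊕ U'-invertible) V-invertible) (suc s') (s≤s s'≤t)
                rows-zero π π-injective π-independent
    where
    K : Matrix (suc n) (suc c)
    K = 1⊕ U' ⊗ H
    K≡ : ∀ i j → ((1⊕ U' ⊗ V) ⊗ G) i j ≡ K i j
    K≡ i j = ⊗-assoc (1⊕ U') V G i j
    K-suc : ∀ i j → K (suc i) j ≡ (U' · (λ k → H (suc k) j)) i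
    K-suc i j = 1⊕-·-suc U' (λ k → H k j) i
    K-zero : ∀ j → K zero j ≡ H zero j
    K-zero j = 1⊕-·-zero U' (λ k → H k j)
    K-column-zero : ∀ i → toℕ i < t → K (suc i) zero ≡ 0ℤ
    K-column-zero i i<t = trans (K-suc i zero)
      (IdentityOutside-·-preserves-zero (proj₁ U'-invertible) (λ k → H (suc k) zero)
                                        (λ k k<t → V-clears (suc k) (s≤s z≤n) (s≤s k<t)) i i<t)
    rows-zero : ∀ i → suc s' ≤ toℕ i → toℕ i < suc t → ∀ j → ((1⊕ U' ⊗ V) ⊗ G) i j ≡ 0ℤ
    rows-zero (suc i) (s≤s s'≤i) (s≤s i<t) zero = trans (K≡ (suc i) zero) (K-column-zero i i<t)
    rows-zero (suc i) (s≤s s'≤i) (s≤s i<t) (suc j) = trans (K≡ (suc i) (suc j)) (trans (K-suc i (suc j)) (rows-zero' i s'≤i i<t j))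
    π : Fin (suc s') → Fin (suc c)
    π zero = zero
    π (suc l) = suc (π' l)
    π-injective : Inj π
    π-injective {zero} {zero} e = refl
    π-injective {suc x} {suc y} e = cong suc (π'-injective (suc-injective e))
    K-independent : Independent (λ l (i : Fin ∣ initSeg (suc n) (suc s') ∣) → K (enum (initSeg (suc n) (suc s')) i) (π l))
    K-independent c h = c≡0
      where
      lower-rows : ∀ i → lincomb (λ l (i : Fin ∣ initSeg n s' ∣) → (U' ⊗ H') (enum (initSeg n s') i) (π' l)) (c ∘ suc) i ≡ 0ℤ
      lower-rows i = trans (sym (trans (cong₂ _+ℤ_ (trans (cong (_* c zero) (K-column-zero e e<t)) (*-zeroˡ (c zero)))
                                                   (sumᶠ-cong (λ l → cong (_* c (suc l)) (K-suc e (suc (π' l))))))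
                                       (+-identityˡ _)))
                           (h (suc i))
        where
        e = enum (initSeg n s') i
        e<t : toℕ e < t
        e<t = ℕP.<-≤-trans (enum-initSeg< n s' i) s'≤t
      c-suc≡0 : ∀ l → c (suc l) ≡ 0ℤ
      c-suc≡0 = π'-independent (c ∘ suc) lower-rows
      c-zero≡0 : c zero ≡ 0ℤ
      c-zero≡0 = *-cancel-nonzero (H zero zero) (c zero) corner≢0
        (trans (cong (_* c zero) (sym (K-zero zero)))
          (trans (sym (+-identityʳ (K zero zero * c zero)))
            (trans (cong (K zero zero * c zero +ℤ_)
                         (sym (sumᶠ-zero {s'} (λ l → trans (cong (K zero (suc (π' l)) *_) (c-suc≡0 l)) (*-zeroʳ (K zero (suc (π' l))))))))
              (h zero))))
      c≡0 : ∀ l → c l ≡ 0ℤ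
      c≡0 zero = c-zero≡0
      c≡0 (suc l) = c-suc≡0 l
    π-independent : Independent (λ l (i : Fin ∣ initSeg (suc n) (suc s') ∣) → ((1⊕ U' ⊗ V) ⊗ G) (enum (initSeg (suc n) (suc s')) i) (π l))
    π-independent = independent-cong (λ l i → sym (K≡ (enum (initSeg (suc n) (suc s')) i) (π l))) K-independent

echelon : ∀ {n c} (t : ℕ) → t ≤ n → (G : Matrix n c) → Echelon t G
echelon {n} zero _ G = echelonForm (idMat n) (InvertibleIn-idMat 0) 0 z≤n (λ i _ ()) (λ ()) (λ { {()} }) (λ c h ())
echelon {n} {zero} (suc t) _ G = echelonForm (idMat n) (InvertibleIn-idMat (suc t)) 0 z≤n (λ i _ _ ()) (λ ()) (λ { {()} }) (λ c h ())
echelon {suc n} {suc c} (suc t) (s≤s t≤n) G with all? (λ i → (toℕ i <? suc t) →-dec (G i zero ℤ.≟ 0ℤ))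
... | yes column-zero = echelon-zero-column (suc t) G column-zero (echelon (suc t) (s≤s t≤n) (λ i j → G i (suc j)))
... | no not-zero with find-nonzero (suc t) (λ i → G i zero) not-zero | clear-column t (s≤s t≤n) (λ i → G i zero)
...   | (i₀ , i₀<t+1 , G-i₀≢0) | (V , V-invertible , V-clears) =
  PivotStep.extend t G i₀ i₀<t+1 G-i₀≢0 V V-invertible V-clears (echelon t t≤n _)

-- Construction of P

rows≤⇒rank : ∀ {r m k} (X : Matrix r m) (f : Fin k → Fin m) → Inj f → Independent (col X ∘ f) → r ≤ k → Rank X k
rows≤⇒rank {r} X f f-injective f-independent r≤k =
  (f , f-injective , f-independent) ,
  λ g _ g-independent → dependent⇒¬independent (col X ∘ g) (dependent-if-wider r (col X ∘ g) (s≤s r≤k)) g-independent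

rank-echelon : ∀ {n c} (Y : Matrix n c) (s : ℕ) (π : Fin s → Fin c) → Inj π →
  Independent (λ l (i : Fin ∣ initSeg n s ∣) → Y (enum (initSeg n s) i) (π l)) →
  (∀ i → s ≤ toℕ i → ∀ j → Y i j ≡ 0ℤ) → Rank Y s
rank-echelon {n} Y s π π-injective π-independent rows-zero =
  (π , π-injective , λ c h → π-independent c (λ i → h (enum (initSeg n s) i))) ,
  λ g _ g-independent → dependent⇒¬independent (col Y ∘ g)
    (dependent-if-supported (col Y ∘ g) ∣ initSeg n s ∣ (enum (initSeg n s)) (λ x x∉ j → outside-zero x x∉ (g j))
                            (s≤s (∣initSeg∣≤ n s)))
    g-independent
  where
  outside-zero : ∀ x → (∀ l → ¬ enum (initSeg n s) l ≡ x) → ∀ j → Y x j ≡ 0ℤ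
  outside-zero x x∉ j with toℕ x ℕP.<? s
  ... | yes x<s = ⊥-elim (x∉ (proj₁ (enum-initSeg-onto n s x x<s)) (proj₂ (enum-initSeg-onto n s x x<s)))
  ... | no x≮s = rows-zero x (ℕP.≮⇒≥ x≮s) j

m∸[m∸n]≤n : ∀ r s → r ∸ (r ∸ s) ≤ s
m∸[m∸n]≤n zero s = ℕP.≤-trans (ℕP.≤-reflexive (ℕP.0∸n≡0 (0 ∸ s))) z≤n
m∸[m∸n]≤n (suc r) zero = ℕP.≤-reflexive (ℕP.n∸n≡0 r)
m∸[m∸n]≤n (suc r) (suc s) = ℕP.≤-trans (ℕP.≤-reflexive (ℕP.+-∸-assoc 1 (ℕP.m∸n≤m r s))) (s≤s (m∸[m∸n]≤n r s))

opposite-< : ∀ {r} s1 (x : Fin r) → r ∸ s1 ≤ toℕ x → toℕ (opposite x) < s1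
opposite-< {r} s1 x h = ℕP.≤-trans (ℕP.≤-reflexive (cong suc (opposite-prop x)))
  (ℕP.≤-trans (ℕP.∸-monoʳ-< {r} {suc (toℕ x)} {r ∸ s1} (s≤s h) (toℕ<n x)) (m∸[m∸n]≤n r s1))

opposite-≥ : ∀ {r} s1 (k : Fin r) → s1 ≤ r → toℕ k < r ∸ s1 → s1 ≤ toℕ (opposite k)
opposite-≥ {r} s1 k s1≤r lt = ℕP.≤-trans
  (ℕP.m+n≤o⇒m≤o∸n s1 (ℕP.≤-trans (ℕP.≤-reflexive (ℕP.+-comm s1 (suc (toℕ k)))) (ℕP.m≤o∸n⇒m+n≤o (suc (toℕ k)) s1≤r lt)))
  (ℕP.≤-reflexive (sym (opposite-prop k)))

opposite-≥-∸ : ∀ {r} s1 (e : Fin r) → toℕ e < s1 → r ∸ s1 ≤ toℕ (opposite e)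
opposite-≥-∸ {r} s1 e lt = ℕP.≤-trans (ℕP.∸-monoʳ-≤ r lt) (ℕP.≤-reflexive (sym (opposite-prop e)))

reverseRows : ∀ {r} → Matrix r r
reverseRows {r} i j = idMat r (opposite i) j

reverseRows-⊗ : ∀ {r c} (M : Matrix r c) i j → (reverseRows ⊗ M) i j ≡ M (opposite i) j
reverseRows-⊗ M i j = sumᶠ-idMatˡ (opposite i) (λ k → M k j)

reverseRows-invertible : ∀ {r} → Invertible (reverseRows {r})
reverseRows-invertible {r} = reverseRows , h , h
  where h : ∀ i j → (reverseRows ⊗ reverseRows) i j ≡ idMat r i j
        h i j = trans (reverseRows-⊗ reverseRows i j) (cong (λ x → idMat r x j) (opposite-involutive i))

-- U₁ puts A^{∁Q} in echelon form, with a' pivot rows; reversing the rows brings its r − a' zero rows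
-- to the top, and U₂, acting on those rows only, puts their Q-part in echelon form with s₂ pivot
-- rows.  Then N = U₂ · reverse · U₁ · A is supported on s₂ + a' independent rows, so s₂ = a − a'.
module Construction {r m : ℕ} (A : Matrix r m) (Q : Subset m) (a a' : ℕ)
  (rankA : Rank A a) (rankA∁Q : Rank (cols (∁ Q) A) a') (e₁ : Echelon r (cols (∁ Q) A)) where

  open Echelon e₁ using () renaming (U to U₁; U-invertible to U₁-invertible; s to s₁; s≤t to s₁≤r;
    rows-zero to rows-zero₁; pivot to π₁; pivot-injective to π₁-injective; pivot-independent to π₁-independent)

  X : Matrix r ∣ ∁ Q ∣
  X = cols (∁ Q) A

  t : ℕ
  t = r ∸ s₁

  M₁ : Matrix r m
  M₁ = reverseRows ⊗ (U₁ ⊗ A)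

  G : Matrix r ∣ Q ∣
  G = cols Q M₁

  M₁≡ : ∀ k j → M₁ k j ≡ (U₁ ⊗ A) (opposite k) j
  M₁≡ k j = reverseRows-⊗ (U₁ ⊗ A) k j

  M₁-top-zero : ∀ j k → toℕ k < t → M₁ k (enum (∁ Q) j) ≡ 0ℤ
  M₁-top-zero j k k<t = trans (M₁≡ k (enum (∁ Q) j)) (rows-zero₁ (opposite k) (opposite-≥ s₁ k s₁≤r k<t) (toℕ<n _) j)

  s₁≡a' : s₁ ≡ a'
  s₁≡a' = rank-unique (U₁ ⊗ X) (rank-echelon (U₁ ⊗ X) s₁ π₁ π₁-injective π₁-independent (λ i s₁≤i j → rows-zero₁ i s₁≤i (toℕ<n i) j))
            (rank-invertible-⊗ (invertibleIn⇒invertible U₁-invertible) X rankA∁Q)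

  module _ (e₂ : Echelon t G) where
    open Echelon e₂ using () renaming (U to U₂; U-invertible to U₂-invertible; s to s₂; s≤t to s₂≤t;
      rows-zero to rows-zero₂; pivot to π₂; pivot-injective to π₂-injective; pivot-independent to π₂-independent)

    P : Matrix r r
    P = U₂ ⊗ (reverseRows ⊗ U₁)

    N : Matrix r m
    N = P ⊗ A

    N≡ : ∀ i j → N i j ≡ (U₂ ⊗ M₁) i j
    N≡ i j = trans (⊗-assoc U₂ (reverseRows ⊗ U₁) A i j) (⊗-congʳ U₂ (⊗-assoc reverseRows U₁ A) i j)

    N-top-∁Q : ∀ i j → toℕ i < t → N i (enum (∁ Q) j) ≡ 0ℤ
    N-top-∁Q i j i<t = trans (N≡ i (enum (∁ Q) j))
      (IdentityOutside-·-preserves-zero (proj₁ U₂-invertible) (λ k → M₁ k (enum (∁ Q) j)) (M₁-top-zero j) i i<t)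

    N-middle-Q : ∀ i j → s₂ ≤ toℕ i → toℕ i < t → N i (enum Q j) ≡ 0ℤ
    N-middle-Q i j s₂≤i i<t = trans (N≡ i (enum Q j)) (rows-zero₂ i s₂≤i i<t j)

    N-bottom : ∀ i j → t ≤ toℕ i → N i j ≡ (U₁ ⊗ A) (opposite i) j
    N-bottom i j t≤i = trans (N≡ i j) (trans (IdentityOutside-·-outside (proj₁ U₂-invertible) (λ k → M₁ k j) i t≤i) (M₁≡ i j))

    P-invertible : Invertible P
    P-invertible = ⊗-invertible {P = U₂} {Q = reverseRows ⊗ U₁} (invertibleIn⇒invertible U₂-invertible)
                     (⊗-invertible {P = reverseRows} {Q = U₁} reverseRows-invertible (invertibleIn⇒invertible U₁-invertible))

    pivots : Fin (s₂ ℕ.+ s₁) → Fin m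
    pivots = append (enum Q ∘ π₂) (enum (∁ Q) ∘ π₁)

    pivots-injective : Inj pivots
    pivots-injective = append-injective (enum Q ∘ π₂) (enum (∁ Q) ∘ π₁)
      (λ e → π₂-injective (enum-injective Q e)) (λ e → π₁-injective (enum-injective (∁ Q) e))
      (λ l y → enum≢enum∁ Q (π₂ l) (π₁ y))

    F₂ : Family s₂ r
    F₂ = col N ∘ enum Q ∘ π₂

    F₁ : Family s₁ r
    F₁ = col N ∘ enum (∁ Q) ∘ π₁

    -- On the top s₂ rows only the F₂ columns survive; on the rows reversed from U₁'s pivot rows,
    -- once the F₂ coefficients are known to vanish, only the F₁ columns remain.
    pivots-independent : Independent (append F₂ F₁)
    pivots-independent c hc = all-↑-zero {s₂} {s₁} c c₂≡0 c₁≡0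
      where
      c₂ : Vector s₂
      c₂ l = c (l ↑ˡ s₁)
      c₁ : Vector s₁
      c₁ y = c (s₂ ↑ʳ y)
      split : ∀ x → lincomb F₂ c₂ x +ℤ lincomb F₁ c₁ x ≡ 0ℤ
      split x = trans (sym (lincomb-append F₂ F₁ c x)) (hc x)
      c₂≡0 : ∀ l → c₂ l ≡ 0ℤ
      c₂≡0 = π₂-independent c₂ λ i →
        let x = enum (initSeg r s₂) i
            x<t = ℕP.<-≤-trans (enum-initSeg< r s₂ i) s₂≤t
            F₁-zero = sumᶠ-zero {s₁} (λ y → trans (cong (_* c₁ y) (N-top-∁Q x (π₁ y) x<t)) (*-zeroˡ (c₁ y)))
        in trans (sumᶠ-cong (λ l → cong (_* c₂ l) (sym (N≡ x (enum Q (π₂ l))))))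
                 (trans (sym (+-identityʳ (lincomb F₂ c₂ x))) (trans (cong (lincomb F₂ c₂ x +ℤ_) (sym F₁-zero)) (split x)))
      c₁≡0 : ∀ y → c₁ y ≡ 0ℤ
      c₁≡0 = π₁-independent c₁ λ i →
        let e = enum (initSeg r s₁) i
            t≤x = opposite-≥-∸ s₁ e (enum-initSeg< r s₁ i)
            entry : ∀ y → N (opposite e) (enum (∁ Q) (π₁ y)) ≡ (U₁ ⊗ X) e (π₁ y)
            entry y = trans (N-bottom (opposite e) (enum (∁ Q) (π₁ y)) t≤x)
                            (cong (λ z → (U₁ ⊗ A) z (enum (∁ Q) (π₁ y))) (opposite-involutive e))
        in trans (sumᶠ-cong (λ y → cong (_* c₁ y) (sym (entry y))))
                 (trans (sym (+-identityˡ (lincomb F₁ c₁ (opposite e))))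
                        (trans (cong (_+ℤ lincomb F₁ c₁ (opposite e)) (sym (lincomb-zeroʳ F₂ c₂≡0 (opposite e))))
                               (split (opposite e))))

    support : Fin (∣ initSeg r s₂ ∣ ℕ.+ ∣ initSeg r s₁ ∣) → Fin r
    support = append (enum (initSeg r s₂)) (opposite ∘ enum (initSeg r s₁))

    outside-support : ∀ x → (∀ l → ¬ support l ≡ x) → ∀ y → N x y ≡ 0ℤ
    outside-support x x∉ y with toℕ x ℕP.<? s₂
    ... | yes x<s₂ = ⊥-elim (x∉ (proj₁ k ↑ˡ ∣ initSeg r s₁ ∣)
            (trans (append-↑ˡ {∣ initSeg r s₂ ∣} {∣ initSeg r s₁ ∣} (enum (initSeg r s₂)) (opposite ∘ enum (initSeg r s₁)) (proj₁ k))
                   (proj₂ k)))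
      where k = enum-initSeg-onto r s₂ x x<s₂
    ... | no x≮s₂ with toℕ x ℕP.<? t | enum-cover Q y
    ...   | yes x<t | inj₁ (j , refl) = N-middle-Q x j (ℕP.≮⇒≥ x≮s₂) x<t
    ...   | yes x<t | inj₂ (j , refl) = N-top-∁Q x j x<t
    ...   | no x≮t | _ = ⊥-elim (x∉ (∣ initSeg r s₂ ∣ ↑ʳ proj₁ k)
            (trans (append-↑ʳ {∣ initSeg r s₂ ∣} {∣ initSeg r s₁ ∣} (enum (initSeg r s₂)) (opposite ∘ enum (initSeg r s₁)) (proj₁ k))
                   (trans (cong opposite (proj₂ k)) (opposite-involutive x))))
      where k = enum-initSeg-onto r s₁ (opposite x) (opposite-< s₁ x (ℕP.≮⇒≥ x≮t))

    rankN : Rank N (s₂ ℕ.+ s₁)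
    rankN = (pivots , pivots-injective ,
             independent-cong (λ x i → sym (cong (λ v → v i) (append-map (col N) (enum Q ∘ π₂) (enum (∁ Q) ∘ π₁) x))) pivots-independent) ,
      λ g _ g-independent → dependent⇒¬independent (col N ∘ g)
        (dependent-if-supported (col N ∘ g) (∣ initSeg r s₂ ∣ ℕ.+ ∣ initSeg r s₁ ∣) support
          (λ x x∉ j → outside-support x x∉ (g j)) (s≤s (ℕP.+-mono-≤ (∣initSeg∣≤ r s₂) (∣initSeg∣≤ r s₁))))
        g-independent

    s₂≡a∸a' : s₂ ≡ a ∸ a'
    s₂≡a∸a' = trans (sym (ℕP.m+n∸n≡m s₂ s₁))
                    (cong₂ _∸_ (rank-unique N rankN (rank-invertible-⊗ P-invertible A rankA)) s₁≡a')

    rankB : Rank (rows (initSeg r s₂) (cols Q N)) s₂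
    rankB = rows≤⇒rank (rows (initSeg r s₂) (cols Q N)) π₂ π₂-injective
              (independent-cong (λ l i → sym (N≡ (enum (initSeg r s₂) i) (enum Q (π₂ l)))) π₂-independent)
              (∣initSeg∣≤ r s₂)

    rank-top-right : Rank (rows (initSeg r s₂) (cols (∁ Q) N)) 0
    rank-top-right = zero⇒rank0 (rows (initSeg r s₂) (cols (∁ Q) N))
      (λ i j → N-top-∁Q (enum (initSeg r s₂) i) j (ℕP.<-≤-trans (enum-initSeg< r s₂ i) s₂≤t))

  P-exists : Σ (Matrix r r) λ P → Invertible P
               × Rank (rows (initSeg r (a ∸ a')) (cols Q (P ⊗ A))) (a ∸ a')
               × Rank (rows (initSeg r (a ∸ a')) (cols (∁ Q) (P ⊗ A))) 0
  P-exists = P e₂ , P-invertible e₂ ,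
    subst (λ s → Rank (rows (initSeg r s) (cols Q (N e₂))) s × Rank (rows (initSeg r s) (cols (∁ Q) (N e₂))) 0)
          (s₂≡a∸a' e₂) (rankB e₂ , rank-top-right e₂)
    where
    e₂ : Echelon t G
    e₂ = echelon t (ℕP.m∸n≤m r s₁) G

lemma4p2 : {r m : ℕ} (A : Matrix r m) (Q : Subset m) (a a' : ℕ) →
    Rank A a → Rank (cols (∁ Q) A) a' → a' < a →
    let rQ = a ∸ a'
        R = initSeg r rQ
        Good = λ (P : Matrix r r) → Invertible P
                 × Rank (rows R (cols Q (P ⊗ A))) rQ
                 × Rank (rows R (cols (∁ Q) (P ⊗ A))) 0
    in Σ (Matrix r r) Good
       × ((P : Matrix r r) → Good P →
           let B = rows R (cols Q (P ⊗ A))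
           in Rank (rows (∁ R) (cols (∁ Q) (P ⊗ A))) (a ∸ rQ)
              × (Abundant A → Abundant B)
              × ((b : Vector r) (x : Vector m) → Sol A b x →
                   Sol B (restrict R (P · b)) (restrict Q x))
              × (Positive A → Positive B)
              × ((Q' : Subset ∣ Q ∣) → Σ (Subset m) λ Q'' →
                   Q'' ⊆ Q × ∣ Q'' ∣ ≡ ∣ Q' ∣
                   × ((k k' : ℕ) → RQ A Q'' k → RQ B Q' k' → k ≡ k')))
lemma4p2 A Q a a' rankA rankA∁Q a'<a =
  Construction.P-exists A Q a a' rankA rankA∁Q (echelon _ ℕP.≤-refl (cols (∁ Q) A)) ,
  λ { P (P-invertible , rankB , rank-top-right) →
      let open Consequences A Q a a' rankA rankA∁Q a'<a P P-invertible rankB rank-top-right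
      in rank-bottom-right , abundant-preserved , solution-restricts , positive-preserved , rQ-lift }
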